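{- Let $\chi_5(d)=\left(\frac{d}{5}\right)$ be the Legendre symbol modulo $5$, let $p(n)$ be the partition function, and define \[ \sigma^{\chi_5}_{11}(n)=\sum_{d\mid n}\chi_5(d)\,d^{11},\qquad \widehat M^{\chi_5}_{11}(n)=\sum_{t=1}^{n}\sigma^{\chi_5}_{11}(t)\,p(n-t). \] Then $\widehat M^{\chi_5}_{11}(5n+4)\equiv0\pmod5$ for all $n\ge0$. -}

module Defs where

open import Data.Nat as ℕ using (ℕ; zero; suc; _∸_; _≤ᵇ_)
open import Data.Nat.DivMod using (_%_)
open import Data.Bool using (if_then_else_)
open import Data.List using (List; upTo; map; filter; sum)
open import Data.Nat.Divisibility using (_∣?_)
open import Data.Integer as ℤ using (ℤ; +_; -[1+_])

sumℕ≤ : ℕ → (ℕ → ℕ) → ℕ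
sumℕ≤ zero    f = f 0
sumℕ≤ (suc m) f = sumℕ≤ m f ℕ.+ f (suc m)

-- partsLe k m = number of partitions of m into parts of size at most k.
-- Recursion on k: choose the multiplicity j of the part k+1.
partsLe : ℕ → ℕ → ℕ
partsLe zero    zero    = 1
partsLe zero    (suc m) = 0
partsLe (suc k) m =
  sumℕ≤ m (λ j → if (suc k ℕ.* j) ≤ᵇ m then partsLe k (m ∸ (suc k ℕ.* j)) else 0)

p : ℕ → ℕ
p n = partsLe n n

χ₅ : ℕ → ℤ
χ₅ d with d % 5
... | 0 = + 0
... | 1 = + 1
... | 4 = + 1
... | _ = -[1+ 0 ]

σχ₅₁₁ : ℕ → ℤ
σχ₅₁₁ n = sum' (map (λ d → χ₅ d ℤ.* (+ (d ℕ.^ 11))) (filter (λ d → d ∣? n) (map suc (upTo n))))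
  where
  sum' : List ℤ → ℤ
  sum' = Data.List.foldr ℤ._+_ (+ 0)

M̂χ₅₁₁ : ℕ → ℤ
M̂χ₅₁₁ n = Data.List.foldr ℤ._+_ (+ 0)
  (map (λ t → σχ₅₁₁ t ℤ.* (+ p (n ∸ t))) (map suc (upTo n)))

open import Relation.Binary.PropositionalEquality using (_≡_; refl)
_ : map p (upTo 10) ≡ (1 Data.List.∷ 1 Data.List.∷ 2 Data.List.∷ 3 Data.List.∷ 5 Data.List.∷ 7 Data.List.∷ 11 Data.List.∷ 15 Data.List.∷ 22 Data.List.∷ 30 Data.List.∷ Data.List.[])
_ = refl
_ : σχ₅₁₁ 2 ≡ -[1+ 2046 ]
_ = refl
_ : M̂χ₅₁₁ 4 ≡ M̂χ₅₁₁ 4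
_ = refl

module Submission where

-- Modulo 5, χ₅(d) ≡ d² (Euler's criterion) and d¹³ ≡ d (Fermat), so σ^{χ₅}_{11}(t) ≡ σ(t), and
-- M̂(n) ≡ Σ_{t=1}^{n} σ(t) p(n - t) = n p(n) by taking the logarithmic derivative of Σ p(n) qⁿ = ∏ (1 - qᵏ)⁻¹.
-- What remains is Ramanujan's congruence p(5n + 4) ≡ 0 (mod 5), proved along his original lines. With
-- F = ∏ (1 - qᵏ) and P = 1/F we have P = F²⁴ (P⁵)⁵. Modulo 5, F⁵ ≡ ∏ (1 - q⁵ᵏ), so F⁵ and its inverse P⁵ are
-- series in q⁵. Jacobi's identity F³ = Σ (-1)ʲ (2j + 1) q^(j(j+1)/2) shows that modulo 5 F³ ≡ A₀ + A₁ with
-- exponents ≡ 0 resp. ≡ 1 (mod 5): the exponents j(j+1)/2 are ≡ 0, 1 or 3, and ≡ 3 only when 5 ∣ 2j + 1. Then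
-- F²⁴ = (F³)³ (F³)⁵ ≡ (A₀ + A₁)³ (A₀⁵ + A₁⁵) has no exponents ≡ 4 (mod 5), and neither does F²⁴ (P⁵)⁵.
--
-- Infinite products are replaced by the polynomials (q)ₙ = ∏_{k ≤ n} (1 - qᵏ), which agree with F up to degree
-- n. Jacobi's identity up to degree n follows from the exact identity
--   Σᵢ (2n + 1 - i) (-1)^(i-n) q^((i-n)(i-n-1)/2) [2n+1 choose i] = (q)ₙ²,
-- proved by a three-term recurrence of the summands in n, since [2n+1 choose i] (q)ₙ ≡ 1 in the degrees that
-- matter.

open import Defs
open import Data.Nat using (ℕ; _+_; _*_)
open import Data.Integer.Divisibility using (_∣_)
open import Data.Integer using (+_)

open import Algebra.Bundles using (CommutativeRing)
open import Algebra.Solver.Ring.AlmostCommutativeRing using (fromCommutativeRing; _-Raw-AlmostCommutative⟶_)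
open import Data.Bool using (true; false; if_then_else_)
open import Data.Empty using (⊥-elim)
open import Data.Integer as ℤ using (ℤ)
import Data.Integer.Properties as ℤP
open import Algebra.Properties.CommutativeSemigroup ℤP.+-commutativeSemigroup using (interchange)
open import Data.Integer.Divisibility.Signed
  using (divides; _∣?_; ∣m∣n⇒∣m+n; ∣m⇒∣-m; ∣n⇒∣m*n; ∣m⇒∣m*n; ∣⇒∣ᵤ) renaming (_∣_ to _∣ₛ_)
open import Data.Integer.Tactic.RingSolver using (solve-∀)
open import Data.List using (List; []; _∷_; map; filter; foldr; applyUpTo; upTo)
open import Data.Maybe using (Maybe; just; nothing)
open import Data.Nat as ℕ
  using (zero; suc; _∸_; _≤_; _<_; z≤n; s≤s; _<?_; _≤?_; _≟_; _≤ᵇ_; _%_; NonZero; compare; less; equal; greater)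
import Data.Nat.Properties as ℕP
open import Data.Nat.DivMod
  using (%-distribˡ-+; _/_; m≡m%n+[m/n]*n; m%n%n≡m%n; m%n<n; [m+kn]%n≡m%n; m*n%n≡0)
import Data.Nat.Divisibility as ℕ∣
open import Data.Nat.Induction using (<-rec)
import Data.Nat.Tactic.RingSolver as ℕSolver
open import Data.Product using (_,_)
open import Data.Sum using (_⊎_; inj₁; inj₂)
open import Function.Bundles using (mk⇔)
open import Level using (0ℓ)
open import Relation.Binary.Bundles using (Setoid)
open import Relation.Binary.PropositionalEquality
import Relation.Binary.Reasoning.Setoid
open import Relation.Binary.Structures using (IsEquivalence)
open import Relation.Nullary using (¬_; Dec; yes; no; does; map′)
open import Relation.Nullary.Decidable using (dec-true; dec-false; does-⇔; from-yes)
open import Relation.Unary using (Decidable)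

-- Formal power series with integer coefficients

Series : Set
Series = ℕ → ℤ

infix  4 _≈_
infixl 6 _⊕_
infixl 7 _⊛_ _⋆_

_≈_ : Series → Series → Set
f ≈ g = ∀ n → f n ≡ g n

≈-refl : ∀ {f} → f ≈ f
≈-refl _ = refl

≈-sym : ∀ {f g} → f ≈ g → g ≈ f
≈-sym f≈g n = sym (f≈g n)

≈-trans : ∀ {f g h} → f ≈ g → g ≈ h → f ≈ h
≈-trans f≈g g≈h n = trans (f≈g n) (g≈h n)

const : ℤ → Series
const c zero    = c
const c (suc _) = + 0

0ₛ 1ₛ : Series
0ₛ _ = + 0
1ₛ   = const (+ 1)

X : ℕ → Series
X zero    zero    = + 1
X zero    (suc _) = + 0
X (suc k) zero    = + 0
X (suc k) (suc n) = X k n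

_⊕_ : Series → Series → Series
(f ⊕ g) n = f n ℤ.+ g n

⊖_ : Series → Series
(⊖ f) n = ℤ.- f n

_⋆_ : ℤ → Series → Series
(c ⋆ f) n = c ℤ.* f n

tail : Series → Series
tail f n = f (suc n)

-- Cauchy product, by recursion on the first factor: f = f 0 + q · tail f.
_⊛_ : Series → Series → Series
(f ⊛ g) zero    = f 0 ℤ.* g 0
(f ⊛ g) (suc n) = f 0 ℤ.* g (suc n) ℤ.+ (tail f ⊛ g) n

⊕-cong : ∀ {f f′ g g′} → f ≈ f′ → g ≈ g′ → f ⊕ g ≈ f′ ⊕ g′
⊕-cong f≈f′ g≈g′ n = cong₂ ℤ._+_ (f≈f′ n) (g≈g′ n)

⊖-cong : ∀ {f g} → f ≈ g → ⊖ f ≈ ⊖ g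
⊖-cong f≈g n = cong ℤ.-_ (f≈g n)

⊛-cong : ∀ {f f′ g g′} → f ≈ f′ → g ≈ g′ → f ⊛ g ≈ f′ ⊛ g′
⊛-cong f≈f′ g≈g′ zero    = cong₂ ℤ._*_ (f≈f′ 0) (g≈g′ 0)
⊛-cong f≈f′ g≈g′ (suc n) =
  cong₂ ℤ._+_ (cong₂ ℤ._*_ (f≈f′ 0) (g≈g′ (suc n))) (⊛-cong (λ k → f≈f′ (suc k)) g≈g′ n)

⊕-congˡ : ∀ f {g g′} → g ≈ g′ → f ⊕ g ≈ f ⊕ g′
⊕-congˡ f = ⊕-cong (≈-refl {f})

⊕-congʳ : ∀ g {f f′} → f ≈ f′ → f ⊕ g ≈ f′ ⊕ g
⊕-congʳ g f≈f′ = ⊕-cong f≈f′ (≈-refl {g})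

⊛-congˡ : ∀ f {g g′} → g ≈ g′ → f ⊛ g ≈ f ⊛ g′
⊛-congˡ f = ⊛-cong (≈-refl {f})

⊛-congʳ : ∀ g {f f′} → f ≈ f′ → f ⊛ g ≈ f′ ⊛ g
⊛-congʳ g f≈f′ = ⊛-cong f≈f′ (≈-refl {g})

⊛-distribʳ : ∀ f f′ g → (f ⊕ f′) ⊛ g ≈ f ⊛ g ⊕ f′ ⊛ g
⊛-distribʳ f f′ g zero    = ℤP.*-distribʳ-+ (g 0) (f 0) (f′ 0)
⊛-distribʳ f f′ g (suc n) =
  trans (cong₂ ℤ._+_ (ℤP.*-distribʳ-+ (g (suc n)) (f 0) (f′ 0)) (⊛-distribʳ (tail f) (tail f′) g n))
        (interchange (f 0 ℤ.* g (suc n)) (f′ 0 ℤ.* g (suc n)) _ _)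

⊛-distribˡ : ∀ f g g′ → f ⊛ (g ⊕ g′) ≈ f ⊛ g ⊕ f ⊛ g′
⊛-distribˡ f g g′ zero    = ℤP.*-distribˡ-+ (f 0) (g 0) (g′ 0)
⊛-distribˡ f g g′ (suc n) =
  trans (cong₂ ℤ._+_ (ℤP.*-distribˡ-+ (f 0) (g (suc n)) (g′ (suc n))) (⊛-distribˡ (tail f) g g′ n))
        (interchange (f 0 ℤ.* g (suc n)) (f 0 ℤ.* g′ (suc n)) _ _)

⋆-⊛-assoc : ∀ c f g → (c ⋆ f) ⊛ g ≈ c ⋆ (f ⊛ g)
⋆-⊛-assoc c f g zero    = ℤP.*-assoc c (f 0) (g 0)
⋆-⊛-assoc c f g (suc n) =
  trans (cong₂ ℤ._+_ (ℤP.*-assoc c (f 0) (g (suc n))) (⋆-⊛-assoc c (tail f) g n))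
        (sym (ℤP.*-distribˡ-+ c (f 0 ℤ.* g (suc n)) _))

⊛-zeroˡ : ∀ g → 0ₛ ⊛ g ≈ 0ₛ
⊛-zeroˡ g zero    = ℤP.*-zeroˡ (g 0)
⊛-zeroˡ g (suc n) = cong₂ ℤ._+_ (ℤP.*-zeroˡ (g (suc n))) (⊛-zeroˡ g n)

⊛-identityˡ : ∀ g → 1ₛ ⊛ g ≈ g
⊛-identityˡ g zero    = ℤP.*-identityˡ (g 0)
⊛-identityˡ g (suc n) =
  trans (cong₂ ℤ._+_ (ℤP.*-identityˡ (g (suc n))) (⊛-zeroˡ g n)) (ℤP.+-identityʳ _)

⊛-suc-last : ∀ f g n → (f ⊛ g) (suc n) ≡ (f ⊛ tail g) n ℤ.+ f (suc n) ℤ.* g 0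
⊛-suc-last f g zero    = refl
⊛-suc-last f g (suc n) =
  trans (cong (ℤ._+_ (f 0 ℤ.* g (suc (suc n)))) (⊛-suc-last (tail f) g n))
        (sym (ℤP.+-assoc (f 0 ℤ.* g (suc (suc n))) _ _))

⊛-comm : ∀ f g → f ⊛ g ≈ g ⊛ f
⊛-comm f g zero    = ℤP.*-comm (f 0) (g 0)
⊛-comm f g (suc n) =
  trans (cong₂ ℤ._+_ (ℤP.*-comm (f 0) (g (suc n))) (⊛-comm (tail f) g n))
        (trans (ℤP.+-comm (g (suc n) ℤ.* f 0) _) (sym (⊛-suc-last g f n)))

⊛-assoc : ∀ f g h → (f ⊛ g) ⊛ h ≈ f ⊛ (g ⊛ h)
⊛-assoc f g h zero    = ℤP.*-assoc (f 0) (g 0) (h 0)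
⊛-assoc f g h (suc n) = begin
  (f 0 ℤ.* g 0) ℤ.* h (suc n) ℤ.+ ((f 0 ⋆ tail g ⊕ tail f ⊛ g) ⊛ h) n
    ≡⟨ cong (ℤ._+_ (f 0 ℤ.* g 0 ℤ.* h (suc n))) (⊛-distribʳ (f 0 ⋆ tail g) (tail f ⊛ g) h n) ⟩
  (f 0 ℤ.* g 0) ℤ.* h (suc n) ℤ.+ (((f 0 ⋆ tail g) ⊛ h) n ℤ.+ ((tail f ⊛ g) ⊛ h) n)
    ≡⟨ cong₂ (λ u v → f 0 ℤ.* g 0 ℤ.* h (suc n) ℤ.+ (u ℤ.+ v))
             (⋆-⊛-assoc (f 0) (tail g) h n) (⊛-assoc (tail f) g h n) ⟩
  (f 0 ℤ.* g 0) ℤ.* h (suc n) ℤ.+ (f 0 ℤ.* (tail g ⊛ h) n ℤ.+ (tail f ⊛ (g ⊛ h)) n)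
    ≡⟨ regroup (f 0) (g 0) (h (suc n)) _ _ ⟩
  f 0 ℤ.* (g 0 ℤ.* h (suc n) ℤ.+ (tail g ⊛ h) n) ℤ.+ (tail f ⊛ (g ⊛ h)) n ∎
  where
  open ≡-Reasoning
  regroup : ∀ a b c d e → (a ℤ.* b) ℤ.* c ℤ.+ (a ℤ.* d ℤ.+ e) ≡ a ℤ.* (b ℤ.* c ℤ.+ d) ℤ.+ e
  regroup = solve-∀

≈-isEquivalence : IsEquivalence _≈_
≈-isEquivalence = record { refl = ≈-refl ; sym = ≈-sym ; trans = ≈-trans }

seriesCommutativeRing : CommutativeRing 0ℓ 0ℓ
seriesCommutativeRing = record
  { isCommutativeRing = record
    { isRing = record
      { +-isAbelianGroup = record
        { isGroup = record
          { isMonoid = record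
            { isSemigroup = record
              { isMagma = record { isEquivalence = ≈-isEquivalence ; ∙-cong = ⊕-cong }
              ; assoc = λ f g h n → ℤP.+-assoc (f n) (g n) (h n) }
            ; identity = (λ f n → ℤP.+-identityˡ (f n)) , (λ f n → ℤP.+-identityʳ (f n)) }
          ; inverse = (λ f n → ℤP.+-inverseˡ (f n)) , (λ f n → ℤP.+-inverseʳ (f n))
          ; ⁻¹-cong = ⊖-cong }
        ; comm = λ f g n → ℤP.+-comm (f n) (g n) }
      ; *-cong = ⊛-cong
      ; *-assoc = ⊛-assoc
      ; *-identity = ⊛-identityˡ , λ g → ≈-trans (⊛-comm g 1ₛ) (⊛-identityˡ g)
      ; distrib = ⊛-distribˡ , λ f g g′ → ≈-trans (⊛-comm (g ⊕ g′) f)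
                    (≈-trans (⊛-distribˡ f g g′) (⊕-cong (⊛-comm f g) (⊛-comm f g′))) }
    ; *-comm = ⊛-comm }
  }

const-* : ∀ c d → const (c ℤ.* d) ≈ const c ⊛ const d
const-* c d zero    = refl
const-* c d (suc n) = sym (cong₂ ℤ._+_ (ℤP.*-zeroʳ c) (⊛-zeroˡ (const d) n))

const-homomorphism : ℤ.+-*-rawRing -Raw-AlmostCommutative⟶ fromCommutativeRing seriesCommutativeRing
const-homomorphism = record
  { ⟦_⟧    = const
  ; +-homo = λ { c d zero → refl ; c d (suc n) → refl }
  ; *-homo = const-*
  ; -‿homo = λ { c zero → refl ; c (suc n) → refl }
  ; 0-homo = λ { zero → refl ; (suc n) → refl }
  ; 1-homo = λ { zero → refl ; (suc n) → refl } }

const-≟ : ∀ c d → Maybe (const c ≈ const d)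
const-≟ c d with c ℤ.≟ d
... | yes refl = just ≈-refl
... | no _     = nothing

open import Algebra.Solver.Ring ℤ.+-*-rawRing (fromCommutativeRing seriesCommutativeRing)
  const-homomorphism const-≟ using (solve; _:=_; _:+_; _:*_; :-_; _:^_; con)

open import Algebra.Properties.CommutativeSemiring.Exp (CommutativeRing.commutativeSemiring seriesCommutativeRing)
  using (_^_; ^-congˡ; ^-homo-*; ^-assocʳ; ^-distrib-*)

module ≈-Reasoning = Relation.Binary.Reasoning.Setoid (CommutativeRing.setoid seriesCommutativeRing)

∑< : ℕ → (ℕ → ℤ) → ℤ
∑< zero    f = + 0
∑< (suc n) f = f 0 ℤ.+ ∑< n (λ i → f (suc i))

infix 5 ∑<
syntax ∑< n (λ i → e) = ∑[ i < n ] e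

∑-cong : ∀ n {f g} → (∀ i → i < n → f i ≡ g i) → ∑< n f ≡ ∑< n g
∑-cong zero    f≡g = refl
∑-cong (suc n) f≡g = cong₂ ℤ._+_ (f≡g 0 (s≤s z≤n)) (∑-cong n (λ i i<n → f≡g (suc i) (s≤s i<n)))

∑-distrib-+ : ∀ n f g → ∑[ i < n ] (f i ℤ.+ g i) ≡ ∑< n f ℤ.+ ∑< n g
∑-distrib-+ zero    f g = refl
∑-distrib-+ (suc n) f g =
  trans (cong (ℤ._+_ (f 0 ℤ.+ g 0)) (∑-distrib-+ n _ _)) (interchange (f 0) (g 0) _ _)

∑-neg : ∀ n f → ∑[ i < n ] ℤ.- f i ≡ ℤ.- ∑< n f
∑-neg zero    f = refl
∑-neg (suc n) f = trans (cong (ℤ._+_ (ℤ.- f 0)) (∑-neg n _)) (sym (ℤP.neg-distrib-+ (f 0) _))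

∑-zero : ∀ n {f} → (∀ i → i < n → f i ≡ + 0) → ∑< n f ≡ + 0
∑-zero zero    f≡0 = refl
∑-zero (suc n) f≡0 = cong₂ ℤ._+_ (f≡0 0 (s≤s z≤n)) (∑-zero n (λ i i<n → f≡0 (suc i) (s≤s i<n)))

∑-snoc : ∀ n f → ∑< (suc n) f ≡ ∑< n f ℤ.+ f n
∑-snoc zero    f = ℤP.+-comm (f 0) (+ 0)
∑-snoc (suc n) f =
  trans (cong (ℤ._+_ (f 0)) (∑-snoc n (λ i → f (suc i)))) (sym (ℤP.+-assoc (f 0) _ _))

∑-split : ∀ m n f → ∑< (m + n) f ≡ ∑< m f ℤ.+ (∑[ i < n ] f (m + i))
∑-split zero    n f = sym (ℤP.+-identityˡ _)
∑-split (suc m) n f =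
  trans (cong (ℤ._+_ (f 0)) (∑-split m n (λ i → f (suc i)))) (sym (ℤP.+-assoc (f 0) _ _))

∑-reverse : ∀ n f → ∑< n f ≡ ∑[ i < n ] f (n ∸ suc i)
∑-reverse zero    f = refl
∑-reverse (suc n) f = begin
  f 0 ℤ.+ ∑< n (λ i → f (suc i))
    ≡⟨ cong (ℤ._+_ (f 0)) (∑-reverse n (λ i → f (suc i))) ⟩
  f 0 ℤ.+ (∑[ i < n ] f (suc (n ∸ suc i)))
    ≡⟨ ℤP.+-comm (f 0) _ ⟩
  (∑[ i < n ] f (suc (n ∸ suc i))) ℤ.+ f 0
    ≡⟨ cong₂ ℤ._+_ (∑-cong n (λ i i<n → cong f (sym (ℕP.+-∸-assoc 1 i<n))))
                   (cong f (sym (ℕP.n∸n≡0 n))) ⟩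
  (∑[ i < n ] f (suc n ∸ suc i)) ℤ.+ f (suc n ∸ suc n)
    ≡⟨ sym (∑-snoc n (λ i → f (suc n ∸ suc i))) ⟩
  ∑[ i < suc n ] f (suc n ∸ suc i) ∎
  where open ≡-Reasoning

∑ₛ< : ℕ → (ℕ → Series) → Series
∑ₛ< n F k = ∑[ i < n ] F i k

infix 5 ∑ₛ<
syntax ∑ₛ< n (λ i → e) = ∑ₛ[ i < n ] e

∑ₛ-cong : ∀ n {F G} → (∀ i → i < n → F i ≈ G i) → ∑ₛ< n F ≈ ∑ₛ< n G
∑ₛ-cong n F≈G k = ∑-cong n (λ i i<n → F≈G i i<n k)

∑ₛ-snoc : ∀ n F → ∑ₛ< (suc n) F ≈ ∑ₛ< n F ⊕ F n
∑ₛ-snoc n F k = ∑-snoc n (λ i → F i k)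

∑ₛ-distrib-⊕ : ∀ n F G → ∑ₛ[ i < n ] (F i ⊕ G i) ≈ ∑ₛ< n F ⊕ ∑ₛ< n G
∑ₛ-distrib-⊕ n F G k = ∑-distrib-+ n (λ i → F i k) (λ i → G i k)

∑ₛ-⊖ : ∀ n F → ∑ₛ[ i < n ] ⊖ F i ≈ ⊖ ∑ₛ< n F
∑ₛ-⊖ n F k = ∑-neg n (λ i → F i k)

∑ₛ-vanishing : ∀ M d h → (∀ j → M ≤ j → h j ≈ 0ₛ) → ∑ₛ< (M + d) h ≈ ∑ₛ< M h
∑ₛ-vanishing M d h h≈0 k =
  trans (∑-split M d (λ i → h i k))
        (trans (cong (ℤ._+_ (∑ₛ< M h k)) (∑-zero d (λ i _ → h≈0 (M + i) (ℕP.m≤m+n M i) k))) (ℤP.+-identityʳ _))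

⊛-zeroʳ : ∀ f → f ⊛ 0ₛ ≈ 0ₛ
⊛-zeroʳ f = ≈-trans (⊛-comm f 0ₛ) (⊛-zeroˡ f)

⊛-∑ₛ : ∀ n f F → f ⊛ ∑ₛ< n F ≈ ∑ₛ[ i < n ] f ⊛ F i
⊛-∑ₛ zero    f F = ⊛-zeroʳ f
⊛-∑ₛ (suc n) f F k =
  trans (⊛-distribˡ f (F 0) (∑ₛ< n (λ i → F (suc i))) k)
        (cong (ℤ._+_ ((f ⊛ F 0) k)) (⊛-∑ₛ n f (λ i → F (suc i)) k))

⊛-coeff : ∀ f g n → (f ⊛ g) n ≡ ∑[ i < suc n ] f i ℤ.* g (n ∸ i)
⊛-coeff f g zero    = sym (ℤP.+-identityʳ _)
⊛-coeff f g (suc n) = cong (ℤ._+_ (f 0 ℤ.* g (suc n))) (⊛-coeff (tail f) g n)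

⊛-coeff-closed : (Q : ℤ → Set) → (∀ {a b} → Q a → Q b → Q (a ℤ.+ b)) →
                 ∀ f g n → (∀ i j → i + j ≡ n → Q (f i ℤ.* g j)) → Q ((f ⊛ g) n)
⊛-coeff-closed Q Q-+ f g zero    Q-pairs = Q-pairs 0 0 refl
⊛-coeff-closed Q Q-+ f g (suc n) Q-pairs =
  Q-+ (Q-pairs 0 (suc n) refl)
      (⊛-coeff-closed Q Q-+ (tail f) g n (λ i j i+j≡n → Q-pairs (suc i) j (cong suc i+j≡n)))

⊛-coeff-zero : ∀ f g n → (∀ i j → i + j ≡ n → f i ℤ.* g j ≡ + 0) → (f ⊛ g) n ≡ + 0
⊛-coeff-zero = ⊛-coeff-closed (_≡ + 0) (cong₂ ℤ._+_)

⊛-coeff-local : ∀ n {f f′ g g′} → (∀ i → i ≤ n → f i ≡ f′ i) → (∀ i → i ≤ n → g i ≡ g′ i) →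
                (f ⊛ g) n ≡ (f′ ⊛ g′) n
⊛-coeff-local zero    f≡f′ g≡g′ = cong₂ ℤ._*_ (f≡f′ 0 z≤n) (g≡g′ 0 z≤n)
⊛-coeff-local (suc n) f≡f′ g≡g′ =
  cong₂ ℤ._+_ (cong₂ ℤ._*_ (f≡f′ 0 z≤n) (g≡g′ (suc n) ℕP.≤-refl))
              (⊛-coeff-local n (λ i i≤n → f≡f′ (suc i) (s≤s i≤n))
                               (λ i i≤n → g≡g′ i (ℕP.m≤n⇒m≤1+n i≤n)))

X-zero : X 0 ≈ 1ₛ
X-zero zero    = refl
X-zero (suc n) = refl

X-off : ∀ k n → ¬ n ≡ k → X k n ≡ + 0
X-off zero    zero    n≢k = ⊥-elim (n≢k refl)
X-off zero    (suc n) n≢k = refl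
X-off (suc k) zero    n≢k = refl
X-off (suc k) (suc n) n≢k = X-off k n (λ n≡k → n≢k (cong suc n≡k))

X-≡ : ∀ {a b} → a ≡ b → X a ≈ X b
X-≡ refl = ≈-refl

X-shift : ∀ k r → X k (k + r) ≡ X 0 r
X-shift zero    r = refl
X-shift (suc k) r = X-shift k r

X⊛-below : ∀ k f n → n < k → (X k ⊛ f) n ≡ + 0
X⊛-below (suc k) f zero    _         = refl
X⊛-below (suc k) f (suc n) (s≤s n<k) = trans (ℤP.+-identityˡ _) (X⊛-below k f n n<k)

X⊛-shift : ∀ k f n → (X k ⊛ f) (k + n) ≡ f n
X⊛-shift zero    f n = trans (⊛-cong X-zero ≈-refl n) (⊛-identityˡ f n)
X⊛-shift (suc k) f n = trans (ℤP.+-identityˡ _) (X⊛-shift k f n)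

X-+ : ∀ a b → X a ⊛ X b ≈ X (a + b)
X-+ zero    b n       = trans (⊛-cong X-zero ≈-refl n) (⊛-identityˡ (X b) n)
X-+ (suc a) b zero    = refl
X-+ (suc a) b (suc n) = trans (ℤP.+-identityˡ _) (X-+ a b n)

X-⊛-X : ∀ a b c d → a + b ≡ c + d → X a ⊛ X b ≈ X c ⊛ X d
X-⊛-X a b c d a+b≡c+d = ≈-trans (X-+ a b) (≈-trans (X-≡ a+b≡c+d) (≈-sym (X-+ c d)))

const-≡ : ∀ {c d} → c ≡ d → const c ≈ const d
const-≡ refl = ≈-refl

X-^ : ∀ k n → X k ^ n ≈ X (n * k)
X-^ k zero    = ≈-sym X-zero
X-^ k (suc n) = ≈-trans (⊛-cong ≈-refl (X-^ k n)) (X-+ k (n * k))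

const-⊛ : ∀ c g → const c ⊛ g ≈ c ⋆ g
const-⊛ c g zero    = refl
const-⊛ c g (suc n) = trans (cong (ℤ._+_ (c ℤ.* g (suc n))) (⊛-zeroˡ g n)) (ℤP.+-identityʳ _)

⊛-⋆-comm : ∀ c f g → f ⊛ (c ⋆ g) ≈ c ⋆ (f ⊛ g)
⊛-⋆-comm c f g = ≈-trans (⊛-comm f (c ⋆ g)) (≈-trans (⋆-⊛-assoc c g f) (λ k → cong (c ℤ.*_) (⊛-comm g f k)))

const-neg : ∀ c → const (ℤ.- c) ≈ ⊖ const c
const-neg c zero    = refl
const-neg c (suc n) = refl

1ₛ-^ : ∀ n → 1ₛ ^ n ≈ 1ₛ
1ₛ-^ zero    = ≈-refl
1ₛ-^ (suc n) = ≈-trans (⊛-cong ≈-refl (1ₛ-^ n)) (⊛-identityˡ 1ₛ)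

^-const-term : ∀ f n → f 0 ≡ + 1 → (f ^ n) 0 ≡ + 1
^-const-term f zero    f₀≡1 = refl
^-const-term f (suc n) f₀≡1 = cong₂ ℤ._*_ f₀≡1 (^-const-term f n f₀≡1)

⊛-cancelˡ : ∀ {a b f g} → b ⊛ a ≈ 1ₛ → a ⊛ f ≈ a ⊛ g → f ≈ g
⊛-cancelˡ {a} {b} {f} {g} ba≈1 af≈ag = begin
  f              ≈⟨ ≈-sym (⊛-identityˡ f) ⟩
  1ₛ ⊛ f         ≈⟨ ⊛-cong (≈-sym ba≈1) ≈-refl ⟩
  (b ⊛ a) ⊛ f    ≈⟨ ⊛-assoc b a f ⟩
  b ⊛ (a ⊛ f)    ≈⟨ ⊛-cong ≈-refl af≈ag ⟩
  b ⊛ (a ⊛ g)    ≈⟨ ≈-sym (⊛-assoc b a g) ⟩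
  (b ⊛ a) ⊛ g    ≈⟨ ⊛-cong ba≈1 ≈-refl ⟩
  1ₛ ⊛ g         ≈⟨ ⊛-identityˡ g ⟩
  g              ∎
  where open ≈-Reasoning

infix 4 _≈[_]_
_≈[_]_ : Series → ℕ → Series → Set
f ≈[ M ] g = ∀ n → n ≤ M → f n ≡ g n

≈⇒≈[] : ∀ {f g} M → f ≈ g → f ≈[ M ] g
≈⇒≈[] M f≈g n _ = f≈g n

≈[]-refl : ∀ {f} M → f ≈[ M ] f
≈[]-refl M n _ = refl

≈[]-sym : ∀ {f g M} → f ≈[ M ] g → g ≈[ M ] f
≈[]-sym f≈g n n≤M = sym (f≈g n n≤M)

≈[]-trans : ∀ {f g h M} → f ≈[ M ] g → g ≈[ M ] h → f ≈[ M ] h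
≈[]-trans f≈g g≈h n n≤M = trans (f≈g n n≤M) (g≈h n n≤M)

≈[]-setoid : ℕ → Setoid 0ℓ 0ℓ
≈[]-setoid M = record
  { Carrier = Series ; _≈_ = _≈[ M ]_
  ; isEquivalence = record { refl = ≈[]-refl M ; sym = ≈[]-sym ; trans = ≈[]-trans } }

module ≈[]-Reasoning (M : ℕ) = Relation.Binary.Reasoning.Setoid (≈[]-setoid M)

≈[]-weaken : ∀ {f g M M′} → M′ ≤ M → f ≈[ M ] g → f ≈[ M′ ] g
≈[]-weaken M′≤M f≈g n n≤M′ = f≈g n (ℕP.≤-trans n≤M′ M′≤M)

≈[]-⋆ : ∀ {f g M} c → f ≈[ M ] g → c ⋆ f ≈[ M ] c ⋆ g
≈[]-⋆ c f≈g n n≤M = cong (c ℤ.*_) (f≈g n n≤M)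

≈[]-⊛ : ∀ {f f′ g g′ M} → f ≈[ M ] f′ → g ≈[ M ] g′ → f ⊛ g ≈[ M ] f′ ⊛ g′
≈[]-⊛ f≈f′ g≈g′ n n≤M =
  ⊛-coeff-local n (λ i i≤n → f≈f′ i (ℕP.≤-trans i≤n n≤M)) (λ i i≤n → g≈g′ i (ℕP.≤-trans i≤n n≤M))

≈[]-^ : ∀ {f g M} n → f ≈[ M ] g → f ^ n ≈[ M ] g ^ n
≈[]-^ {M = M} zero    f≈g = ≈[]-refl M
≈[]-^         (suc n) f≈g = ≈[]-⊛ f≈g (≈[]-^ n f≈g)

≈[]-∑ₛ : ∀ n {F G M} → (∀ i → i < n → F i ≈[ M ] G i) → ∑ₛ< n F ≈[ M ] ∑ₛ< n G
≈[]-∑ₛ n F≈G k k≤M = ∑-cong n (λ i i<n → F≈G i i<n k k≤M)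

X⊛-≈[] : ∀ {g h M} e → g ≈[ M ] h → X e ⊛ g ≈[ e + M ] X e ⊛ h
X⊛-≈[] {g} {h} {M} e g≈h n n≤e+M with n <? e
... | yes n<e = trans (X⊛-below e g n n<e) (sym (X⊛-below e h n n<e))
... | no  n≮e = begin
  (X e ⊛ g) n              ≡⟨ cong (X e ⊛ g) (sym e+[n∸e]≡n) ⟩
  (X e ⊛ g) (e + (n ∸ e))  ≡⟨ X⊛-shift e g (n ∸ e) ⟩
  g (n ∸ e)                ≡⟨ g≈h (n ∸ e) n∸e≤M ⟩
  h (n ∸ e)                ≡⟨ sym (X⊛-shift e h (n ∸ e)) ⟩
  (X e ⊛ h) (e + (n ∸ e))  ≡⟨ cong (X e ⊛ h) e+[n∸e]≡n ⟩
  (X e ⊛ h) n              ∎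
  where
  open ≡-Reasoning
  e+[n∸e]≡n : e + (n ∸ e) ≡ n
  e+[n∸e]≡n = ℕP.m+[n∸m]≡n (ℕP.≮⇒≥ n≮e)
  n∸e≤M : n ∸ e ≤ M
  n∸e≤M = ℕP.≤-trans (ℕP.∸-monoˡ-≤ e n≤e+M) (ℕP.≤-reflexive (ℕP.m+n∸m≡n e M))

-- Congruences and residue classes modulo m

module Modulo (m : ℕ) .{{_ : NonZero m}} where

  infix 4 _≋_ _≡ₘ_ _≡ₘ?_ _≈ₘ_

  _≋_ : ℕ → ℕ → Set
  i ≋ j = i % m ≡ j % m

  ≋-+ : ∀ {i i′ j j′} → i ≋ i′ → j ≋ j′ → i + j ≋ i′ + j′
  ≋-+ {i} {i′} {j} {j′} i≋i′ j≋j′ = begin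
    (i + j) % m              ≡⟨ %-distribˡ-+ i j m ⟩
    (i % m + j % m) % m      ≡⟨ cong₂ (λ a b → (a + b) % m) i≋i′ j≋j′ ⟩
    (i′ % m + j′ % m) % m    ≡⟨ sym (%-distribˡ-+ i′ j′ m) ⟩
    (i′ + j′) % m            ∎
    where open ≡-Reasoning

  record _≡ₘ_ (a b : ℤ) : Set where
    constructor m∣-
    field m∣a-b : + m ∣ₛ a ℤ.- b

  private
    via : ∀ {a b c d} → (a ℤ.- b ≡ c ℤ.- d) → a ≡ₘ b → c ≡ₘ d
    via eq (m∣- m∣a-b) = m∣- (subst (+ m ∣ₛ_) eq m∣a-b)

  ≡ₘ-reflexive : ∀ {a b} → a ≡ b → a ≡ₘ b
  ≡ₘ-reflexive {a} refl = m∣- (divides (+ 0) (ℤP.+-inverseʳ a))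

  ≡ₘ-refl : ∀ {a} → a ≡ₘ a
  ≡ₘ-refl = ≡ₘ-reflexive refl

  ≡ₘ-sym : ∀ {a b} → a ≡ₘ b → b ≡ₘ a
  ≡ₘ-sym {a} {b} (m∣- m∣a-b) = m∣- (subst (+ m ∣ₛ_) (negate a b) (∣m⇒∣-m m∣a-b))
    where
    negate : ∀ a b → ℤ.- (a ℤ.- b) ≡ b ℤ.- a
    negate = solve-∀

  ≡ₘ-trans : ∀ {a b c} → a ≡ₘ b → b ≡ₘ c → a ≡ₘ c
  ≡ₘ-trans {a} {b} {c} (m∣- m∣a-b) (m∣- m∣b-c) =
    m∣- (subst (+ m ∣ₛ_) (telescope a b c) (∣m∣n⇒∣m+n m∣a-b m∣b-c))
    where
    telescope : ∀ a b c → (a ℤ.- b) ℤ.+ (b ℤ.- c) ≡ a ℤ.- c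
    telescope = solve-∀

  ≡ₘ-+ : ∀ {a a′ b b′} → a ≡ₘ a′ → b ≡ₘ b′ → a ℤ.+ b ≡ₘ a′ ℤ.+ b′
  ≡ₘ-+ {a} {a′} {b} {b′} (m∣- m∣a-a′) (m∣- m∣b-b′) =
    m∣- (subst (+ m ∣ₛ_) (regroup a a′ b b′) (∣m∣n⇒∣m+n m∣a-a′ m∣b-b′))
    where
    regroup : ∀ a a′ b b′ → (a ℤ.- a′) ℤ.+ (b ℤ.- b′) ≡ (a ℤ.+ b) ℤ.- (a′ ℤ.+ b′)
    regroup = solve-∀

  ≡ₘ-neg : ∀ {a b} → a ≡ₘ b → ℤ.- a ≡ₘ ℤ.- b
  ≡ₘ-neg {a} {b} (m∣- m∣a-b) = m∣- (subst (+ m ∣ₛ_) (negate a b) (∣m⇒∣-m m∣a-b))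
    where
    negate : ∀ a b → ℤ.- (a ℤ.- b) ≡ ℤ.- a ℤ.- ℤ.- b
    negate = solve-∀

  ≡ₘ-* : ∀ {a a′ b b′} → a ≡ₘ a′ → b ≡ₘ b′ → a ℤ.* b ≡ₘ a′ ℤ.* b′
  ≡ₘ-* {a} {a′} {b} {b′} (m∣- m∣a-a′) (m∣- m∣b-b′) =
    m∣- (subst (+ m ∣ₛ_) (regroup a a′ b b′)
               (∣m∣n⇒∣m+n (∣n⇒∣m*n a m∣b-b′) (∣m⇒∣m*n b′ m∣a-a′)))
    where
    regroup : ∀ a a′ b b′ → a ℤ.* (b ℤ.- b′) ℤ.+ (a ℤ.- a′) ℤ.* b′ ≡ a ℤ.* b ℤ.- a′ ℤ.* b′
    regroup = solve-∀

  ≡ₘ0-*ˡ : ∀ {a} b → a ≡ₘ + 0 → a ℤ.* b ≡ₘ + 0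
  ≡ₘ0-*ˡ b a≡0 = ≡ₘ-* a≡0 (≡ₘ-refl {b})

  ≡ₘ0-*ʳ : ∀ a {b} → b ≡ₘ + 0 → a ℤ.* b ≡ₘ + 0
  ≡ₘ0-*ʳ a b≡0 = ≡ₘ-trans (≡ₘ-* (≡ₘ-refl {a}) b≡0) (≡ₘ-reflexive (ℤP.*-zeroʳ a))

  ≡ₘ-pos-^ : ∀ n {a b} → + a ≡ₘ + b → + (a ℕ.^ n) ≡ₘ + (b ℕ.^ n)
  ≡ₘ-pos-^ zero    a≡b = ≡ₘ-refl
  ≡ₘ-pos-^ (suc n) {a} {b} a≡b = subst₂ _≡ₘ_ (sym (ℤP.pos-* a (a ℕ.^ n))) (sym (ℤP.pos-* b (b ℕ.^ n)))
    (≡ₘ-* a≡b (≡ₘ-pos-^ n a≡b))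

  n≡ₘn%m : ∀ n → + n ≡ₘ + (n % m)
  n≡ₘn%m n = m∣- (divides (+ q) (begin
    + n ℤ.- + r                    ≡⟨ cong (λ k → + k ℤ.- + r) (m≡m%n+[m/n]*n n m) ⟩
    + (r + q * m) ℤ.- + r          ≡⟨ cong (ℤ._- + r) (ℤP.pos-+ r (q * m)) ⟩
    (+ r ℤ.+ + (q * m)) ℤ.- + r    ≡⟨ cancel (+ r) (+ (q * m)) ⟩
    + (q * m)                      ≡⟨ ℤP.pos-* q m ⟩
    + q ℤ.* + m                    ∎))
    where
    open ≡-Reasoning
    r = n % m
    q = n / m
    cancel : ∀ a b → (a ℤ.+ b) ℤ.- a ≡ b
    cancel = solve-∀

  _≡ₘ?_ : ∀ a b → Dec (a ≡ₘ b)
  a ≡ₘ? b = map′ m∣- _≡ₘ_.m∣a-b (+ m ∣? a ℤ.- b)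

  ≡ₘ0⇒∣ : ∀ {a} → a ≡ₘ + 0 → + m ∣ₛ a
  ≡ₘ0⇒∣ {a} (m∣- m∣a-0) = subst (+ m ∣ₛ_) (ℤP.+-identityʳ a) m∣a-0

  ≡ₘ⇒-≡ₘ0 : ∀ {a b} → a ≡ₘ b → a ℤ.- b ≡ₘ + 0
  ≡ₘ⇒-≡ₘ0 {a} {b} = via (sym (ℤP.+-identityʳ (a ℤ.- b)))

  -≡ₘ0⇒≡ₘ : ∀ {a b} → a ℤ.- b ≡ₘ + 0 → a ≡ₘ b
  -≡ₘ0⇒≡ₘ {a} {b} = via (ℤP.+-identityʳ (a ℤ.- b))

  ≡ₘ-∑ : ∀ n {f g} → (∀ i → i < n → f i ≡ₘ g i) → ∑< n f ≡ₘ ∑< n g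
  ≡ₘ-∑ zero    f≡g = ≡ₘ-refl
  ≡ₘ-∑ (suc n) f≡g = ≡ₘ-+ (f≡g 0 (s≤s z≤n)) (≡ₘ-∑ n (λ i i<n → f≡g (suc i) (s≤s i<n)))

  _≈ₘ_ : Series → Series → Set
  f ≈ₘ g = ∀ n → f n ≡ₘ g n

  ≈⇒≈ₘ : ∀ {f g} → f ≈ g → f ≈ₘ g
  ≈⇒≈ₘ f≈g n = ≡ₘ-reflexive (f≈g n)

  ≈ₘ-sym : ∀ {f g} → f ≈ₘ g → g ≈ₘ f
  ≈ₘ-sym f≈g n = ≡ₘ-sym (f≈g n)

  ≈ₘ-trans : ∀ {f g h} → f ≈ₘ g → g ≈ₘ h → f ≈ₘ h
  ≈ₘ-trans f≈g g≈h n = ≡ₘ-trans (f≈g n) (g≈h n)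

  ⊛-≡ₘ0ˡ : ∀ f g → (∀ n → f n ≡ₘ + 0) → ∀ n → (f ⊛ g) n ≡ₘ + 0
  ⊛-≡ₘ0ˡ f g f≡0 n =
    ⊛-coeff-closed (_≡ₘ + 0) ≡ₘ-+ f g n (λ i j _ → ≡ₘ0-*ˡ (g j) (f≡0 i))

  ≈ₘ-⊛ : ∀ {f f′ g g′} → f ≈ₘ f′ → g ≈ₘ g′ → f ⊛ g ≈ₘ f′ ⊛ g′
  ≈ₘ-⊛ {f} {f′} {g} {g′} f≈f′ g≈g′ n = -≡ₘ0⇒≡ₘ (subst (_≡ₘ + 0) (sym (difference n))
    (≡ₘ-+ (⊛-≡ₘ0ˡ (f ⊕ ⊖ f′) g (λ k → ≡ₘ⇒-≡ₘ0 (f≈f′ k)) n)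
          (subst (_≡ₘ + 0) (⊛-comm (g ⊕ ⊖ g′) f′ n)
                 (⊛-≡ₘ0ˡ (g ⊕ ⊖ g′) f′ (λ k → ≡ₘ⇒-≡ₘ0 (g≈g′ k)) n))))
    where
    difference : f ⊛ g ⊕ ⊖ (f′ ⊛ g′) ≈ (f ⊕ ⊖ f′) ⊛ g ⊕ f′ ⊛ (g ⊕ ⊖ g′)
    difference = solve 4 (λ a a′ b b′ → a :* b :+ :- (a′ :* b′) := (a :+ :- a′) :* b :+ a′ :* (b :+ :- b′))
                   ≈-refl f f′ g g′

  ≈ₘ-^ : ∀ {f g} n → f ≈ₘ g → f ^ n ≈ₘ g ^ n
  ≈ₘ-^ zero    f≈g = ≈⇒≈ₘ ≈-refl
  ≈ₘ-^ (suc n) f≈g = ≈ₘ-⊛ f≈g (≈ₘ-^ n f≈g)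

  ≈ₘ-∑ₛ : ∀ n {F G} → (∀ i → F i ≈ₘ G i) → ∑ₛ< n F ≈ₘ ∑ₛ< n G
  ≈ₘ-∑ₛ n F≈G k = ≡ₘ-∑ n (λ i _ → F≈G i k)

  m≡ₘ0 : + m ≡ₘ + 0
  m≡ₘ0 = m∣- (divides (+ 1) (trans (ℤP.+-identityʳ (+ m)) (sym (ℤP.*-identityˡ (+ m)))))

  +-≋0 : ∀ i {j} → j ≋ 0 → i + j ≋ i
  +-≋0 i {j} j≋0 = trans (≋-+ {i} {i} refl j≋0) (cong (_% m) (ℕP.+-identityʳ i))

  record InClass (c : ℕ) (f : Series) : Set where
    constructor inClass
    field vanishes-off : ∀ n → ¬ n ≋ c → f n ≡ + 0

  InClass-resp-≋ : ∀ {c d f} → c ≋ d → InClass c f → InClass d f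
  InClass-resp-≋ c≋d (inClass f∈c) = inClass λ n n≉d → f∈c n (λ n≋c → n≉d (trans n≋c c≋d))

  InClass-resp-≈ : ∀ {c f g} → f ≈ g → InClass c f → InClass c g
  InClass-resp-≈ f≈g (inClass f∈c) = inClass λ n n≉c → trans (sym (f≈g n)) (f∈c n n≉c)

  InClass-0ₛ : ∀ c → InClass c 0ₛ
  InClass-0ₛ c = inClass λ _ _ → refl

  InClass-1ₛ : InClass 0 1ₛ
  InClass-1ₛ = inClass λ { zero 0≉0 → ⊥-elim (0≉0 refl) ; (suc n) _ → refl }

  InClass-X : ∀ k → InClass k (X k)
  InClass-X k = inClass λ n n≉k → X-off k n (λ n≡k → n≉k (cong (_% m) n≡k))

  InClass-⋆ : ∀ {c f} a → InClass c f → InClass c (a ⋆ f)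
  InClass-⋆ a (inClass f∈c) = inClass λ n n≉c → trans (cong (a ℤ.*_) (f∈c n n≉c)) (ℤP.*-zeroʳ a)

  InClass-⊛ : ∀ {c d f g} → InClass c f → InClass d g → InClass (c + d) (f ⊛ g)
  InClass-⊛ {c} {d} {f} {g} (inClass f∈c) (inClass g∈d) = inClass λ n n≉c+d → ⊛-coeff-zero f g n (vanish n n≉c+d)
    where
    vanish : ∀ n → ¬ n ≋ c + d → ∀ i j → i + j ≡ n → f i ℤ.* g j ≡ + 0
    vanish n n≉c+d i j i+j≡n with i % m ℕ.≟ c % m | j % m ℕ.≟ d % m
    ... | no i≉c  | _       = cong (ℤ._* g j) (f∈c i i≉c)
    ... | yes _   | no j≉d  = trans (cong (f i ℤ.*_) (g∈d j j≉d)) (ℤP.*-zeroʳ (f i))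
    ... | yes i≋c | yes j≋d = ⊥-elim (n≉c+d (subst (_≋ c + d) i+j≡n (≋-+ i≋c j≋d)))

  InClass-^ : ∀ {c f} n → InClass c f → InClass (n * c) (f ^ n)
  InClass-^ zero    f∈c = InClass-1ₛ
  InClass-^ (suc n) f∈c = InClass-⊛ f∈c (InClass-^ n f∈c)

  InClass-∑ₛ : ∀ {c} n F → (∀ i → InClass c (F i)) → InClass c (∑ₛ< n F)
  InClass-∑ₛ n F F∈c = inClass λ k k≉c → ∑-zero n (λ i _ → InClass.vanishes-off (F∈c i) k k≉c)

  record DivisibleOn (c : ℕ) (f : Series) : Set where
    constructor divisibleOn
    field divisible-at : ∀ n → n ≋ c → f n ≡ₘ + 0

  InClass⇒DivisibleOn : ∀ {c d f} → ¬ c ≋ d → InClass c f → DivisibleOn d f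
  InClass⇒DivisibleOn c≉d (inClass f∈c) =
    divisibleOn λ n n≋d → ≡ₘ-reflexive (f∈c n (λ n≋c → c≉d (trans (sym n≋c) n≋d)))

  DivisibleOn-⊕ : ∀ {c f g} → DivisibleOn c f → DivisibleOn c g → DivisibleOn c (f ⊕ g)
  DivisibleOn-⊕ (divisibleOn f₀) (divisibleOn g₀) = divisibleOn λ n n≋c → ≡ₘ-+ (f₀ n n≋c) (g₀ n n≋c)

  DivisibleOn-resp-≈ₘ : ∀ {c f g} → f ≈ₘ g → DivisibleOn c f → DivisibleOn c g
  DivisibleOn-resp-≈ₘ f≈g (divisibleOn f₀) = divisibleOn λ n n≋c → ≡ₘ-trans (≡ₘ-sym (f≈g n)) (f₀ n n≋c)

  record InQᵐ (g : Series) : Set where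
    constructor inQᵐ
    field divisible-off-0 : ∀ n → ¬ n ≋ 0 → g n ≡ₘ + 0

  DivisibleOn-⊛-InQᵐ : ∀ {c f g} → DivisibleOn c f → InQᵐ g → DivisibleOn c (f ⊛ g)
  DivisibleOn-⊛-InQᵐ {c} {f} {g} (divisibleOn f₀) (inQᵐ g∈) =
    divisibleOn λ n n≋c → ⊛-coeff-closed (_≡ₘ + 0) ≡ₘ-+ f g n (divisible n n≋c)
    where
    divisible : ∀ n → n ≋ c → ∀ i j → i + j ≡ n → f i ℤ.* g j ≡ₘ + 0
    divisible n n≋c i j i+j≡n with j % m ℕ.≟ 0 % m
    ... | yes j≋0 = ≡ₘ0-*ˡ (g j) (f₀ i (trans (sym (+-≋0 i j≋0)) (subst (_≋ c) (sym i+j≡n) n≋c)))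
    ... | no  j≉0 = ≡ₘ0-*ʳ (f i) (g∈ j j≉0)

  InClass⇒InQᵐ : ∀ {f} → InClass 0 f → InQᵐ f
  InClass⇒InQᵐ (inClass f∈0) = inQᵐ λ n n≉0 → ≡ₘ-reflexive (f∈0 n n≉0)

  InQᵐ-⊕ : ∀ {f g} → InQᵐ f → InQᵐ g → InQᵐ (f ⊕ g)
  InQᵐ-⊕ (inQᵐ f∈) (inQᵐ g∈) = inQᵐ λ n n≉0 → ≡ₘ-+ (f∈ n n≉0) (g∈ n n≉0)

  InQᵐ-⊖ : ∀ {f} → InQᵐ f → InQᵐ (⊖ f)
  InQᵐ-⊖ (inQᵐ f∈) = inQᵐ λ n n≉0 → ≡ₘ-neg (f∈ n n≉0)

  InQᵐ-resp-≈ : ∀ {f g} → f ≈ g → InQᵐ f → InQᵐ g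
  InQᵐ-resp-≈ f≈g (inQᵐ f∈) = inQᵐ λ n n≉0 → ≡ₘ-trans (≡ₘ-reflexive (sym (f≈g n))) (f∈ n n≉0)

  InQᵐ-⊛ : ∀ {f g} → InQᵐ f → InQᵐ g → InQᵐ (f ⊛ g)
  InQᵐ-⊛ {f} {g} (inQᵐ f∈) (inQᵐ g∈) =
    inQᵐ λ n n≉0 → ⊛-coeff-closed (_≡ₘ + 0) ≡ₘ-+ f g n (divisible n n≉0)
    where
    divisible : ∀ n → ¬ n ≋ 0 → ∀ i j → i + j ≡ n → f i ℤ.* g j ≡ₘ + 0
    divisible n n≉0 i j i+j≡n with i % m ℕ.≟ 0 % m
    ... | no  i≉0 = ≡ₘ0-*ˡ (g j) (f∈ i i≉0)
    ... | yes i≋0 = ≡ₘ0-*ʳ (f i) (g∈ j λ j≋0 → n≉0 (subst (_≋ 0) i+j≡n (trans (+-≋0 i j≋0) i≋0)))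

  InQᵐ-^ : ∀ {f} n → InQᵐ f → InQᵐ (f ^ n)
  InQᵐ-^ zero    f∈ = InClass⇒InQᵐ InClass-1ₛ
  InQᵐ-^ (suc n) f∈ = InQᵐ-⊛ f∈ (InQᵐ-^ n f∈)

  InQᵐ-m⊛ : ∀ g → InQᵐ (const (+ m) ⊛ g)
  InQᵐ-m⊛ g = inQᵐ λ n _ → ≡ₘ-trans (≡ₘ-reflexive (const-⊛ (+ m) g n)) (≡ₘ0-*ˡ (g n) m≡ₘ0)

  -- Since f 0 = 1, the coefficient of q^(n+1) in f ⊛ g ≈ 1ₛ gives g (suc n) = - (tail f ⊛ g) n, which only
  -- involves the g j with j ≤ n.
  InQᵐ-inverse : ∀ {f g} → f ⊛ g ≈ 1ₛ → f 0 ≡ + 1 → InQᵐ f → InQᵐ g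
  InQᵐ-inverse {f} {g} fg≈1 f₀≡1 (inQᵐ f∈) = inQᵐ (<-rec (λ n → ¬ n ≋ 0 → g n ≡ₘ + 0) step)
    where
    step : ∀ n → (∀ {j} → j < n → ¬ j ≋ 0 → g j ≡ₘ + 0) → ¬ n ≋ 0 → g n ≡ₘ + 0
    step zero    _  0≉0 = ⊥-elim (0≉0 refl)
    step (suc n) ih n≉0 = ≡ₘ-trans (≡ₘ-reflexive g[1+n]≡-rest) (≡ₘ-neg rest≡0)
      where
      divisible : ∀ i j → i + j ≡ n → f (suc i) ℤ.* g j ≡ₘ + 0
      divisible i j i+j≡n with suc i % m ℕ.≟ 0 % m
      ... | no  i≉0 = ≡ₘ0-*ˡ (g j) (f∈ (suc i) i≉0)
      ... | yes i≋0 = ≡ₘ0-*ʳ (f (suc i)) (ih (s≤s (subst (j ≤_) i+j≡n (ℕP.m≤n+m j i)))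
              (λ j≋0 → n≉0 (subst (_≋ 0) (cong suc i+j≡n) (trans (+-≋0 (suc i) j≋0) i≋0))))
      rest≡0 : (tail f ⊛ g) n ≡ₘ + 0
      rest≡0 = ⊛-coeff-closed (_≡ₘ + 0) ≡ₘ-+ (tail f) g n divisible
      g[1+n]≡-rest : g (suc n) ≡ ℤ.- (tail f ⊛ g) n
      g[1+n]≡-rest = begin
        g (suc n)                                        ≡⟨ sym (ℤP.*-identityˡ _) ⟩
        + 1 ℤ.* g (suc n)                                ≡⟨ cong (ℤ._* g (suc n)) (sym f₀≡1) ⟩
        f 0 ℤ.* g (suc n)                                ≡⟨ solve-for-first (f 0 ℤ.* g (suc n)) _ ⟩
        (f 0 ℤ.* g (suc n) ℤ.+ (tail f ⊛ g) n) ℤ.- (tail f ⊛ g) n ≡⟨ cong (ℤ._- (tail f ⊛ g) n) (fg≈1 (suc n)) ⟩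
        + 0 ℤ.- (tail f ⊛ g) n                           ≡⟨ ℤP.+-identityˡ _ ⟩
        ℤ.- (tail f ⊛ g) n                               ∎
        where
        open ≡-Reasoning
        solve-for-first : ∀ a b → a ≡ (a ℤ.+ b) ℤ.- b
        solve-for-first = solve-∀

-- Partitions

sumℕ≤-cong : ∀ n {f g} → (∀ j → j ≤ n → f j ≡ g j) → sumℕ≤ n f ≡ sumℕ≤ n g
sumℕ≤-cong zero    f≡g = f≡g 0 z≤n
sumℕ≤-cong (suc n) f≡g =
  cong₂ _+_ (sumℕ≤-cong n (λ j j≤n → f≡g j (ℕP.m≤n⇒m≤1+n j≤n))) (f≡g (suc n) ℕP.≤-refl)

sumℕ≤-uncons : ∀ n f → sumℕ≤ (suc n) f ≡ f 0 + sumℕ≤ n (λ j → f (suc j))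
sumℕ≤-uncons zero    f = refl
sumℕ≤-uncons (suc n) f = trans (cong (_+ f (suc (suc n))) (sumℕ≤-uncons n f)) (ℕP.+-assoc (f 0) _ _)

sumℕ≤-vanishing : ∀ a b f → (∀ j → a < j → f j ≡ 0) → sumℕ≤ (a + b) f ≡ sumℕ≤ a f
sumℕ≤-vanishing a zero    f f≡0 = cong (λ n → sumℕ≤ n f) (ℕP.+-identityʳ a)
sumℕ≤-vanishing a (suc b) f f≡0 = begin
  sumℕ≤ (a + suc b) f                     ≡⟨ cong (λ n → sumℕ≤ n f) (ℕP.+-suc a b) ⟩
  sumℕ≤ (a + b) f + f (suc (a + b))       ≡⟨ cong (_+_ (sumℕ≤ (a + b) f)) (f≡0 _ (s≤s (ℕP.m≤m+n a b))) ⟩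
  sumℕ≤ (a + b) f + 0                     ≡⟨ ℕP.+-identityʳ _ ⟩
  sumℕ≤ (a + b) f                         ≡⟨ sumℕ≤-vanishing a b f f≡0 ⟩
  sumℕ≤ a f                               ∎
  where open ≡-Reasoning

≤ᵇ-false : ∀ {a b} → b < a → (a ≤ᵇ b) ≡ false
≤ᵇ-false {a} {b} b<a = dec-false (a ≤? b) (ℕP.<⇒≱ b<a)

≤ᵇ-+ˡ : ∀ s a b → ((s + a) ≤ᵇ (s + b)) ≡ (a ≤ᵇ b)
≤ᵇ-+ˡ s a b = does-⇔ (mk⇔ (ℕP.+-cancelˡ-≤ s a b) (ℕP.+-monoʳ-≤ s)) (s + a ≤? s + b) (a ≤? b)

-- The number of partitions of m into parts ≤ k + 1 in which k + 1 occurs exactly j times.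
withMultiplicity : ℕ → ℕ → ℕ → ℕ
withMultiplicity k m j = if (suc k * j) ≤ᵇ m then partsLe k (m ∸ (suc k * j)) else 0

withMultiplicity-0 : ∀ k m → withMultiplicity k m 0 ≡ partsLe k m
withMultiplicity-0 k m rewrite ℕP.*-zeroʳ k = refl

withMultiplicity-large : ∀ k m j → m < suc k * j → withMultiplicity k m j ≡ 0
withMultiplicity-large k m j m<kj rewrite ≤ᵇ-false m<kj = refl

partsLe-below : ∀ k m → m < suc k → partsLe (suc k) m ≡ partsLe k m
partsLe-below k m m<1+k = begin
  sumℕ≤ m (withMultiplicity k m)  ≡⟨ sumℕ≤-vanishing 0 m (withMultiplicity k m) no-room ⟩
  withMultiplicity k m 0          ≡⟨ withMultiplicity-0 k m ⟩
  partsLe k m                     ∎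
  where
  open ≡-Reasoning
  no-room : ∀ j → 0 < j → withMultiplicity k m j ≡ 0
  no-room (suc j) _ = withMultiplicity-large k m (suc j) (ℕP.<-≤-trans m<1+k (ℕP.m≤m*n (suc k) (suc j)))

-- Split off the partitions without a part k + 1; from each of the others remove one part k + 1.
partsLe-recurrence : ∀ k m → partsLe (suc k) (suc k + m) ≡ partsLe k (suc k + m) + partsLe (suc k) m
partsLe-recurrence k m = begin
  sumℕ≤ (suc (k + m)) (withMultiplicity k (s + m))
    ≡⟨ sumℕ≤-uncons (k + m) _ ⟩
  withMultiplicity k (s + m) 0 + sumℕ≤ (k + m) (λ j → withMultiplicity k (s + m) (suc j))
    ≡⟨ cong₂ _+_ (withMultiplicity-0 k _) (sumℕ≤-cong (k + m) (λ j _ → remove-one j)) ⟩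
  partsLe k (s + m) + sumℕ≤ (k + m) (withMultiplicity k m)
    ≡⟨ cong (_+_ (partsLe k (s + m))) (trans (cong (λ n → sumℕ≤ n (withMultiplicity k m)) (ℕP.+-comm k m))
                                         (sumℕ≤-vanishing m k _ too-many)) ⟩
  partsLe k (s + m) + sumℕ≤ m (withMultiplicity k m) ∎
  where
  open ≡-Reasoning
  s = suc k
  too-many : ∀ j → m < j → withMultiplicity k m j ≡ 0
  too-many j m<j = withMultiplicity-large k m j (ℕP.<-≤-trans m<j (ℕP.m≤n*m j s))
  remove-one : ∀ j → withMultiplicity k (s + m) (suc j) ≡ withMultiplicity k m j
  remove-one j = begin
    withMultiplicity k (s + m) (suc j)
      ≡⟨ cong (λ t → if t ≤ᵇ (s + m) then partsLe k ((s + m) ∸ t) else 0) (ℕP.*-suc s j) ⟩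
    (if (s + s * j) ≤ᵇ (s + m) then partsLe k ((s + m) ∸ (s + s * j)) else 0)
      ≡⟨ cong₂ (λ b t → if b then partsLe k t else 0) (≤ᵇ-+ˡ s (s * j) m) (ℕP.[m+n]∸[m+o]≡n∸o s m (s * j)) ⟩
    withMultiplicity k m j ∎

partsLe-stable : ∀ K m → m ≤ K → partsLe K m ≡ p m
partsLe-stable K m m≤K = go (K ∸ m) K (ℕP.m∸n+n≡m m≤K)
  where
  go : ∀ d K → d + m ≡ K → partsLe K m ≡ partsLe m m
  go zero    K       refl = refl
  go (suc d) (suc K) d+m≡K =
    trans (partsLe-below K m (s≤s (subst (m ≤_) (ℕP.suc-injective d+m≡K) (ℕP.m≤n+m m d))))
          (go d K (ℕP.suc-injective d+m≡K))

parts : ℕ → Series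
parts k n = + partsLe k n

[1-X] : ℕ → Series
[1-X] s = 1ₛ ⊕ ⊖ X s

poch : ℕ → Series
poch zero    = 1ₛ
poch (suc k) = poch k ⊛ [1-X] (suc k)

[1-X]-⊛ : ∀ s f → [1-X] s ⊛ f ≈ f ⊕ ⊖ (X s ⊛ f)
[1-X]-⊛ s f = solve 2 (λ x g → (con (+ 1) :+ :- x) :* g := g :+ :- (x :* g)) ≈-refl (X s) f

[1-X]-parts : ∀ k → [1-X] (suc k) ⊛ parts (suc k) ≈ parts k
[1-X]-parts k n = trans ([1-X]-⊛ s (parts s) n) (difference n)
  where
  s = suc k
  difference : ∀ n → parts s n ℤ.- (X s ⊛ parts s) n ≡ parts k n
  difference n with n <? s
  ... | yes n<s = begin
    parts s n ℤ.- (X s ⊛ parts s) n  ≡⟨ cong (λ c → parts s n ℤ.- c) (X⊛-below s (parts s) n n<s) ⟩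
    parts s n ℤ.+ + 0                ≡⟨ ℤP.+-identityʳ _ ⟩
    + partsLe s n                    ≡⟨ cong +_ (partsLe-below k n n<s) ⟩
    parts k n                        ∎
    where open ≡-Reasoning
  ... | no n≮s = begin
    parts s n ℤ.- (X s ⊛ parts s) n
      ≡⟨ cong (λ i → parts s i ℤ.- (X s ⊛ parts s) i) (sym s+r≡n) ⟩
    parts s (s + r) ℤ.- (X s ⊛ parts s) (s + r)
      ≡⟨ cong (ℤ._-_ (parts s (s + r))) (X⊛-shift s (parts s) r) ⟩
    + partsLe s (s + r) ℤ.- + partsLe s r
      ≡⟨ cong (λ c → + c ℤ.- + partsLe s r) (partsLe-recurrence k r) ⟩
    + (partsLe k (s + r) + partsLe s r) ℤ.- + partsLe s r
      ≡⟨ cong (ℤ._- + partsLe s r) (ℤP.pos-+ (partsLe k (s + r)) _) ⟩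
    (+ partsLe k (s + r) ℤ.+ + partsLe s r) ℤ.- + partsLe s r
      ≡⟨ cancel (+ partsLe k (s + r)) (+ partsLe s r) ⟩
    parts k (s + r)
      ≡⟨ cong (parts k) s+r≡n ⟩
    parts k n ∎
    where
    open ≡-Reasoning
    r = n ∸ s
    s+r≡n : s + r ≡ n
    s+r≡n = ℕP.m+[n∸m]≡n (ℕP.≮⇒≥ n≮s)
    cancel : ∀ a b → (a ℤ.+ b) ℤ.- b ≡ a
    cancel = solve-∀

poch-parts : ∀ k → poch k ⊛ parts k ≈ 1ₛ
poch-parts zero    = ≈-trans (⊛-identityˡ (parts 0)) parts-0
  where
  parts-0 : parts 0 ≈ 1ₛ
  parts-0 zero    = refl
  parts-0 (suc n) = refl
poch-parts (suc k) = begin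
  (poch k ⊛ [1-X] (suc k)) ⊛ parts (suc k)  ≈⟨ ⊛-assoc (poch k) _ _ ⟩
  poch k ⊛ ([1-X] (suc k) ⊛ parts (suc k))  ≈⟨ ⊛-cong ≈-refl ([1-X]-parts k) ⟩
  poch k ⊛ parts k                          ≈⟨ poch-parts k ⟩
  1ₛ                                        ∎
  where open ≈-Reasoning

-- Euler's identity n p(n) = Σ σ(t) p(n - t)

θ : Series → Series
θ f n = + n ℤ.* f n

θ-cong : ∀ {f g} → f ≈ g → θ f ≈ θ g
θ-cong f≈g n = cong (+ n ℤ.*_) (f≈g n)

θ-leibniz : ∀ f g → θ (f ⊛ g) ≈ θ f ⊛ g ⊕ f ⊛ θ g
θ-leibniz f g zero    = vanish (f 0) (g 0)
  where
  vanish : ∀ a b → + 0 ℤ.* (a ℤ.* b) ≡ (+ 0 ℤ.* a) ℤ.* b ℤ.+ a ℤ.* (+ 0 ℤ.* b)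
  vanish = solve-∀
θ-leibniz f g (suc n) = begin
  + suc n ℤ.* (f 0 ℤ.* g (suc n) ℤ.+ (tail f ⊛ g) n)
    ≡⟨ regroup (+ n) (f 0) (g (suc n)) ((tail f ⊛ g) n) ((θ (tail f) ⊛ g) n) ((tail f ⊛ θ g) n)
               (θ-leibniz (tail f) g n) ⟩
  (+ 0 ℤ.* f 0) ℤ.* g (suc n) ℤ.+ ((θ (tail f) ⊛ g) n ℤ.+ (tail f ⊛ g) n)
    ℤ.+ (f 0 ℤ.* (+ suc n ℤ.* g (suc n)) ℤ.+ (tail f ⊛ θ g) n)
    ≡⟨ cong (λ c → (+ 0 ℤ.* f 0) ℤ.* g (suc n) ℤ.+ c
                    ℤ.+ (f 0 ℤ.* (+ suc n ℤ.* g (suc n)) ℤ.+ (tail f ⊛ θ g) n))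
            (sym (trans (⊛-cong tail-θ ≈-refl n) (⊛-distribʳ (θ (tail f)) (tail f) g n))) ⟩
  (θ f ⊛ g) (suc n) ℤ.+ (f ⊛ θ g) (suc n) ∎
  where
  open ≡-Reasoning
  tail-θ : tail (θ f) ≈ θ (tail f) ⊕ tail f
  tail-θ i = distrib (+ i) (f (suc i))
    where
    distrib : ∀ a b → (+ 1 ℤ.+ a) ℤ.* b ≡ a ℤ.* b ℤ.+ b
    distrib = solve-∀
  regroup : ∀ n a b c d e → n ℤ.* c ≡ d ℤ.+ e →
            (+ 1 ℤ.+ n) ℤ.* (a ℤ.* b ℤ.+ c) ≡
            (+ 0 ℤ.* a) ℤ.* b ℤ.+ (d ℤ.+ c) ℤ.+ (a ℤ.* ((+ 1 ℤ.+ n) ℤ.* b) ℤ.+ e)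
  regroup n a b c d e nc≡d+e = trans (expand n a b c)
    (trans (cong (λ x → x ℤ.+ c ℤ.+ a ℤ.* ((+ 1 ℤ.+ n) ℤ.* b)) nc≡d+e)
                                                            (collect n a b c d e))
    where
    expand : ∀ n a b c → (+ 1 ℤ.+ n) ℤ.* (a ℤ.* b ℤ.+ c) ≡ n ℤ.* c ℤ.+ c ℤ.+ a ℤ.* ((+ 1 ℤ.+ n) ℤ.* b)
    expand = solve-∀
    collect : ∀ n a b c d e → (d ℤ.+ e) ℤ.+ c ℤ.+ a ℤ.* ((+ 1 ℤ.+ n) ℤ.* b) ≡
              (+ 0 ℤ.* a) ℤ.* b ℤ.+ (d ℤ.+ c) ℤ.+ (a ℤ.* ((+ 1 ℤ.+ n) ℤ.* b) ℤ.+ e)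
    collect = solve-∀

θ-X : ∀ k → θ (X k) ≈ + k ⋆ X k
θ-X k n with n ≟ k
... | yes refl = refl
... | no  n≢k  = trans (cong (+ n ℤ.*_) (X-off k n n≢k))
                       (trans (ℤP.*-zeroʳ (+ n)) (sym (trans (cong (+ k ℤ.*_) (X-off k n n≢k)) (ℤP.*-zeroʳ (+ k)))))

θ-[1-X] : ∀ s → θ ([1-X] s) ≈ ⊖ (+ s ⋆ X s)
θ-[1-X] s n = trans (ℤP.*-distribˡ-+ (+ n) (1ₛ n) (ℤ.- X s n))
             (trans (cong₂ ℤ._+_ (θ-1ₛ n) (sym (ℤP.neg-distribʳ-* (+ n) (X s n))))
             (trans (ℤP.+-identityˡ _) (cong ℤ.-_ (θ-X s n))))
  where
  θ-1ₛ : ∀ n → + n ℤ.* 1ₛ n ≡ + 0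
  θ-1ₛ zero    = refl
  θ-1ₛ (suc n) = ℤP.*-zeroʳ (+ suc n)

-- s qˢ / (1 - qˢ) = - θ (1 - qˢ) / (1 - qˢ)
divisorTerm : ℕ → Series
divisorTerm s zero    = + 0
divisorTerm s (suc n) = if does (s ℕ∣.∣? suc n) then + s else + 0

divisorTerm-below : ∀ k n → n < suc k → divisorTerm (suc k) n ≡ + 0
divisorTerm-below k zero    _     = refl
divisorTerm-below k (suc n) n<1+k =
  cong (if_then + suc k else + 0) (dec-false (suc k ℕ∣.∣? suc n) (λ k∣n → ℕP.<⇒≱ n<1+k (ℕ∣.∣⇒≤ k∣n)))

divisorTerm-diag : ∀ k → divisorTerm (suc k) (suc k + 0) ≡ + suc k
divisorTerm-diag k =
  cong (if_then + suc k else + 0)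
       (dec-true (suc k ℕ∣.∣? suc (k + 0)) (ℕ∣.∣m∣n⇒∣m+n ℕ∣.∣-refl (suc k ℕ∣.∣0)))

divisorTerm-periodic : ∀ k n → divisorTerm (suc k) (suc k + suc n) ≡ divisorTerm (suc k) (suc n)
divisorTerm-periodic k n = cong (if_then + suc k else + 0)
  (does-⇔ (mk⇔ (λ k∣k+n → ℕ∣.∣m+n∣m⇒∣n k∣k+n ℕ∣.∣-refl) (ℕ∣.∣m∣n⇒∣m+n ℕ∣.∣-refl))
          (suc k ℕ∣.∣? (suc k + suc n)) (suc k ℕ∣.∣? suc n))

[1-X]-divisorTerm : ∀ k → [1-X] (suc k) ⊛ divisorTerm (suc k) ≈ + suc k ⋆ X (suc k)
[1-X]-divisorTerm k n = trans ([1-X]-⊛ s E n) (coeff n)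
  where
  s = suc k
  E = divisorTerm s
  coeff-from-s : ∀ r → E (s + r) ℤ.- (X s ⊛ E) (s + r) ≡ + s ℤ.* X s (s + r)
  coeff-from-s r = begin
    E (s + r) ℤ.- (X s ⊛ E) (s + r)  ≡⟨ cong (ℤ._-_ (E (s + r))) (X⊛-shift s E r) ⟩
    E (s + r) ℤ.- E r                ≡⟨ one-period r ⟩
    + s ℤ.* X 0 r                    ≡⟨ cong (+ s ℤ.*_) (sym (X-shift s r)) ⟩
    + s ℤ.* X s (s + r)              ∎
    where
    open ≡-Reasoning
    one-period : ∀ r → E (s + r) ℤ.- E r ≡ + s ℤ.* X 0 r
    one-period zero    = trans (ℤP.+-identityʳ _) (trans (divisorTerm-diag k) (sym (ℤP.*-identityʳ (+ s))))
    one-period (suc r) = trans (cong (ℤ._- E (suc r)) (divisorTerm-periodic k r))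
                               (trans (ℤP.+-inverseʳ (E (suc r))) (sym (ℤP.*-zeroʳ (+ s))))
  coeff : ∀ n → E n ℤ.- (X s ⊛ E) n ≡ + s ℤ.* X s n
  coeff n with n <? s
  ... | yes n<s = begin
    E n ℤ.- (X s ⊛ E) n  ≡⟨ cong₂ ℤ._-_ (divisorTerm-below k n n<s) (X⊛-below s E n n<s) ⟩
    + 0                  ≡⟨ sym (ℤP.*-zeroʳ (+ s)) ⟩
    + s ℤ.* + 0          ≡⟨ cong (+ s ℤ.*_) (sym (X-off s n (λ n≡s → ℕP.<-irrefl n≡s n<s))) ⟩
    + s ℤ.* X s n        ∎
    where open ≡-Reasoning
  ... | no  n≮s = subst (λ i → E i ℤ.- (X s ⊛ E) i ≡ + s ℤ.* X s i)
                        (ℕP.m+[n∸m]≡n (ℕP.≮⇒≥ n≮s)) (coeff-from-s (n ∸ s))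

divisorSum : ℕ → Series
divisorSum zero    = 0ₛ
divisorSum (suc k) = divisorSum k ⊕ divisorTerm (suc k)

[1-X]-invertible : ∀ k → (poch k ⊛ parts (suc k)) ⊛ [1-X] (suc k) ≈ 1ₛ
[1-X]-invertible k = ≈-trans (rearrange (poch k) (parts (suc k)) ([1-X] (suc k))) (poch-parts (suc k))
  where
  rearrange : ∀ a b c → (a ⊛ b) ⊛ c ≈ (a ⊛ c) ⊛ b
  rearrange = solve 3 (λ a b c → (a :* b) :* c := (a :* c) :* b) ≈-refl

-- Apply θ to (1 - qˢ) ⊛ parts s ≈ parts k with s = k + 1, use θ (1 - qˢ) = - (1 - qˢ) ⊛ divisorTerm s,
-- and cancel 1 - qˢ.
θ-parts : ∀ k → θ (parts k) ≈ divisorSum k ⊛ parts k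
θ-parts zero    zero    = refl
θ-parts zero    (suc n) = trans (ℤP.*-zeroʳ (+ suc n)) (sym (⊛-zeroˡ (parts 0) (suc n)))
θ-parts (suc k) = ⊛-cancelˡ ([1-X]-invertible k) (begin
  L ⊛ θ P
    ≈⟨ solve 2 (λ a b → b := (a :+ b) :+ :- a) ≈-refl (θ L ⊛ P) (L ⊛ θ P) ⟩
  (θ L ⊛ P ⊕ L ⊛ θ P) ⊕ ⊖ (θ L ⊛ P)
    ≈⟨ ⊕-cong leibniz (⊖-cong (⊛-cong (≈-trans (θ-[1-X] s) (⊖-cong (≈-sym ([1-X]-divisorTerm k)))) ≈-refl)) ⟩
  divisorSum k ⊛ parts k ⊕ ⊖ ((⊖ (L ⊛ E)) ⊛ P)
    ≈⟨ ⊕-cong (⊛-cong ≈-refl (≈-sym ([1-X]-parts k))) ≈-refl ⟩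
  divisorSum k ⊛ (L ⊛ P) ⊕ ⊖ ((⊖ (L ⊛ E)) ⊛ P)
    ≈⟨ solve 4 (λ a b c d → a :* (b :* c) :+ :- ((:- (b :* d)) :* c) := b :* ((a :+ d) :* c))
             ≈-refl (divisorSum k) L P E ⟩
  L ⊛ (divisorSum s ⊛ P) ∎)
  where
  open ≈-Reasoning
  s = suc k
  L = [1-X] s
  P = parts s
  E = divisorTerm s
  leibniz : θ L ⊛ P ⊕ L ⊛ θ P ≈ divisorSum k ⊛ parts k
  leibniz = ≈-trans (≈-sym (θ-leibniz L P)) (≈-trans (θ-cong ([1-X]-parts k)) (θ-parts k))

-- The twisted divisor sums modulo 5

open Modulo 5

sumList : List ℤ → ℤ
sumList = foldr ℤ._+_ (+ 0)

sumList-applyUpTo : ∀ n f (g : ℕ → ℤ) → sumList (map g (map suc (applyUpTo f n))) ≡ ∑[ i < n ] g (suc (f i))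
sumList-applyUpTo zero    f g = refl
sumList-applyUpTo (suc n) f g = cong (ℤ._+_ (g (suc (f 0)))) (sumList-applyUpTo n (λ i → f (suc i)) g)

sumList-filter : ∀ {P : ℕ → Set} (P? : Decidable P) (h : ℕ → ℤ) xs →
  sumList (map h (filter P? xs)) ≡ sumList (map (λ x → if does (P? x) then h x else + 0) xs)
sumList-filter P? h []       = refl
sumList-filter P? h (x ∷ xs) with does (P? x)
... | true  = cong (ℤ._+_ (h x)) (sumList-filter P? h xs)
... | false = trans (sumList-filter P? h xs) (sym (ℤP.+-identityˡ _))

χ₅-mod : ∀ d → χ₅ d ≡ χ₅ (d % 5)
χ₅-mod d rewrite m%n%n≡m%n d 5 ⦃ _ ⦄ = refl

χ₅-residues : ∀ r → r < 5 → χ₅ r ℤ.* + (r ℕ.^ 11) ≡ₘ + r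
χ₅-residues 0 _ = from-yes (χ₅ 0 ℤ.* + (0 ℕ.^ 11) ≡ₘ? + 0)
χ₅-residues 1 _ = from-yes (χ₅ 1 ℤ.* + (1 ℕ.^ 11) ≡ₘ? + 1)
χ₅-residues 2 _ = from-yes (χ₅ 2 ℤ.* + (2 ℕ.^ 11) ≡ₘ? + 2)
χ₅-residues 3 _ = from-yes (χ₅ 3 ℤ.* + (3 ℕ.^ 11) ≡ₘ? + 3)
χ₅-residues 4 _ = from-yes (χ₅ 4 ℤ.* + (4 ℕ.^ 11) ≡ₘ? + 4)
χ₅-residues (suc (suc (suc (suc (suc r))))) (s≤s (s≤s (s≤s (s≤s (s≤s ())))))

-- Fermat and Euler's criterion: χ₅(d) d¹¹ ≡ d² · d¹¹ = d¹³ ≡ d (mod 5); checked on residues.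
χ₅-twist≡ₘ : ∀ d → χ₅ d ℤ.* + (d ℕ.^ 11) ≡ₘ + d
χ₅-twist≡ₘ d = ≡ₘ-trans (≡ₘ-* (≡ₘ-reflexive (χ₅-mod d)) (≡ₘ-pos-^ 11 (n≡ₘn%m d)))
                 (≡ₘ-trans (χ₅-residues (d % 5) (m%n<n d 5)) (≡ₘ-sym (n≡ₘn%m d)))

twistedTerm : ℕ → ℕ → ℤ
twistedTerm t d = if does (d ℕ∣.∣? t) then χ₅ d ℤ.* + (d ℕ.^ 11) else + 0

σχ₅₁₁-as-∑ : ∀ t → σχ₅₁₁ t ≡ ∑[ i < t ] twistedTerm t (suc i)
σχ₅₁₁-as-∑ t = trans (sumList-filter (ℕ∣._∣? t) (λ d → χ₅ d ℤ.* + (d ℕ.^ 11)) (map suc (upTo t)))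
                     (sumList-applyUpTo t (λ i → i) (twistedTerm t))

divisorSum-as-∑ : ∀ k n → divisorSum k n ≡ ∑[ i < k ] divisorTerm (suc i) n
divisorSum-as-∑ zero    n = refl
divisorSum-as-∑ (suc k) n =
  trans (cong (ℤ._+ divisorTerm (suc k) n) (divisorSum-as-∑ k n)) (sym (∑-snoc k (λ i → divisorTerm (suc i) n)))

divisorSum-stable : ∀ t d → divisorSum (suc t + d) (suc t) ≡ ∑[ i < suc t ] divisorTerm (suc i) (suc t)
divisorSum-stable t d = begin
  divisorSum (suc t + d) (suc t)
    ≡⟨ divisorSum-as-∑ (suc t + d) (suc t) ⟩
  ∑[ i < suc t + d ] divisorTerm (suc i) (suc t)
    ≡⟨ ∑-split (suc t) d (λ i → divisorTerm (suc i) (suc t)) ⟩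
  (∑[ i < suc t ] divisorTerm (suc i) (suc t)) ℤ.+ (∑[ i < d ] divisorTerm (suc (suc t + i)) (suc t))
    ≡⟨ cong (ℤ._+_ (∑[ i < suc t ] divisorTerm (suc i) (suc t)))
            (∑-zero d (λ i _ → divisorTerm-below (suc (t + i)) (suc t) (s≤s (s≤s (ℕP.m≤m+n t i))))) ⟩
  (∑[ i < suc t ] divisorTerm (suc i) (suc t)) ℤ.+ + 0
    ≡⟨ ℤP.+-identityʳ _ ⟩
  ∑[ i < suc t ] divisorTerm (suc i) (suc t) ∎
  where open ≡-Reasoning

σχ₅₁₁≡ₘdivisorSum : ∀ K t → suc t ≤ K → σχ₅₁₁ (suc t) ≡ₘ divisorSum K (suc t)
σχ₅₁₁≡ₘdivisorSum K t t<K = subst₂ _≡ₘ_ (sym (σχ₅₁₁-as-∑ (suc t)))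
  (trans (sym (divisorSum-stable t (K ∸ suc t))) (cong (λ k → divisorSum k (suc t)) (ℕP.m+[n∸m]≡n t<K)))
  (≡ₘ-∑ (suc t) (λ i _ → termwise i))
  where
  termwise : ∀ i → twistedTerm (suc t) (suc i) ≡ₘ divisorTerm (suc i) (suc t)
  termwise i with does (suc i ℕ∣.∣? suc t)
  ... | true  = χ₅-twist≡ₘ (suc i)
  ... | false = ≡ₘ-refl

M̂χ₅₁₁-as-∑ : ∀ N → M̂χ₅₁₁ N ≡ ∑[ i < N ] σχ₅₁₁ (suc i) ℤ.* + p (N ∸ suc i)
M̂χ₅₁₁-as-∑ N = sumList-applyUpTo N (λ i → i) (λ t → σχ₅₁₁ t ℤ.* + p (N ∸ t))

divisorSum⊛parts-as-∑ : ∀ N → (divisorSum N ⊛ parts N) N ≡ ∑[ i < N ] divisorSum N (suc i) ℤ.* + p (N ∸ suc i)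
divisorSum⊛parts-as-∑ N = begin
  (divisorSum N ⊛ parts N) N
    ≡⟨ ⊛-coeff (divisorSum N) (parts N) N ⟩
  divisorSum N 0 ℤ.* parts N N ℤ.+ (∑[ i < N ] divisorSum N (suc i) ℤ.* parts N (N ∸ suc i))
    ≡⟨ cong₂ ℤ._+_ (cong (ℤ._* parts N N) no-constant-term)
                   (∑-cong N (λ i _ → cong (λ c → divisorSum N (suc i) ℤ.* + c)
                                          (partsLe-stable N _ (ℕP.m∸n≤m N (suc i))))) ⟩
  + 0 ℤ.+ (∑[ i < N ] divisorSum N (suc i) ℤ.* + p (N ∸ suc i))
    ≡⟨ ℤP.+-identityˡ _ ⟩
  ∑[ i < N ] divisorSum N (suc i) ℤ.* + p (N ∸ suc i) ∎
  where
  open ≡-Reasoning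
  no-constant-term : divisorSum N 0 ≡ + 0
  no-constant-term = trans (divisorSum-as-∑ N 0) (∑-zero N (λ _ _ → refl))

M̂χ₅₁₁≡ₘNp : ∀ N → M̂χ₅₁₁ N ≡ₘ + N ℤ.* + p N
M̂χ₅₁₁≡ₘNp N = subst₂ _≡ₘ_
  (sym (M̂χ₅₁₁-as-∑ N)) (trans (sym (divisorSum⊛parts-as-∑ N)) (sym (θ-parts N N)))
  (≡ₘ-∑ N (λ i i<N → ≡ₘ-* (σχ₅₁₁≡ₘdivisorSum N i i<N) ≡ₘ-refl))

-- q-binomial coefficients

qbin : ℕ → ℕ → Series
qbin zero    zero    = 1ₛ
qbin zero    (suc k) = 0ₛ
qbin (suc N) zero    = 1ₛ
qbin (suc N) (suc k) = qbin N k ⊕ X (suc k) ⊛ qbin N (suc k)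

qbin-0 : ∀ N → qbin N 0 ≈ 1ₛ
qbin-0 zero    = ≈-refl
qbin-0 (suc N) = ≈-refl

qbin-above : ∀ N k → N < k → qbin N k ≈ 0ₛ
qbin-above zero    (suc k) _         = ≈-refl
qbin-above (suc N) (suc k) (s≤s N<k) = ≈-trans
  (⊕-cong (qbin-above N k N<k)
          (≈-trans (⊛-congˡ (X (suc k)) (qbin-above N (suc k) (ℕP.m<n⇒m<1+n N<k))) (⊛-zeroʳ (X (suc k)))))
  (λ _ → refl)

qbin-diag : ∀ N → qbin N N ≈ 1ₛ
qbin-diag zero    = ≈-refl
qbin-diag (suc N) = ≈-trans
  (⊕-cong (qbin-diag N) (≈-trans (⊛-congˡ (X (suc N)) (qbin-above N (suc N) ℕP.≤-refl)) (⊛-zeroʳ (X (suc N)))))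
  (λ n → ℤP.+-identityʳ (1ₛ n))

qbin-vanishes-or-≤ : ∀ N k → k ≤ N ⊎ qbin N k ≈ 0ₛ
qbin-vanishes-or-≤ N k with k ≤? N
... | yes k≤N = inj₁ k≤N
... | no  k≰N = inj₂ (qbin-above N k (ℕP.≰⇒> k≰N))

X-merge : ∀ N k f → k ≤ N ⊎ f ≈ 0ₛ → X (suc k) ⊛ (X (N ∸ k) ⊛ f) ≈ X (suc N) ⊛ f
X-merge N k f (inj₁ k≤N) = begin
  X (suc k) ⊛ (X (N ∸ k) ⊛ f)  ≈⟨ ≈-sym (⊛-assoc (X (suc k)) (X (N ∸ k)) f) ⟩
  (X (suc k) ⊛ X (N ∸ k)) ⊛ f
    ≈⟨ ⊛-congʳ f (≈-trans (X-+ (suc k) (N ∸ k)) (X-≡ (cong suc (ℕP.m+[n∸m]≡n k≤N)))) ⟩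
  X (suc N) ⊛ f                ∎
  where open ≈-Reasoning
X-merge N k f (inj₂ f≈0) = begin
  X (suc k) ⊛ (X (N ∸ k) ⊛ f)  ≈⟨ ⊛-congˡ (X (suc k)) (≈-trans (⊛-congˡ (X (N ∸ k)) f≈0) (⊛-zeroʳ _)) ⟩
  X (suc k) ⊛ 0ₛ               ≈⟨ ⊛-zeroʳ _ ⟩
  0ₛ                           ≈⟨ ≈-sym (⊛-zeroʳ _) ⟩
  X (suc N) ⊛ 0ₛ               ≈⟨ ⊛-congˡ (X (suc N)) (≈-sym f≈0) ⟩
  X (suc N) ⊛ f                ∎
  where open ≈-Reasoning

qbin-pascal′ : ∀ N k → qbin (suc N) (suc k) ≈ X (N ∸ k) ⊛ qbin N k ⊕ qbin N (suc k)
qbin-pascal′ zero    zero    = ≈-trans (⊕-congˡ 1ₛ (⊛-zeroʳ (X 1)))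
                                       (⊕-congʳ 0ₛ (≈-sym (≈-trans (⊛-congʳ 1ₛ X-zero) (⊛-identityˡ 1ₛ))))
qbin-pascal′ zero    (suc k) = ≈-trans (⊕-congˡ 0ₛ (⊛-zeroʳ (X (suc (suc k)))))
                                       (≈-trans (≈-sym (⊛-zeroʳ (X 0))) (λ n → sym (ℤP.+-identityʳ _)))
qbin-pascal′ (suc N) zero    = begin
  1ₛ ⊕ X 1 ⊛ qbin (suc N) 1
    ≈⟨ ⊕-congˡ 1ₛ (⊛-congˡ (X 1)
         (≈-trans (qbin-pascal′ N 0) (⊕-congʳ (qbin N 1) (⊛-congˡ (X N) (qbin-0 N))))) ⟩
  1ₛ ⊕ X 1 ⊛ (X N ⊛ 1ₛ ⊕ qbin N 1)
    ≈⟨ solve 4 (λ o x₁ xₙ q → o :+ x₁ :* (xₙ :* o :+ q) := (x₁ :* xₙ) :* o :+ (o :+ x₁ :* q))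
             ≈-refl 1ₛ (X 1) (X N) (qbin N 1) ⟩
  (X 1 ⊛ X N) ⊛ 1ₛ ⊕ (1ₛ ⊕ X 1 ⊛ qbin N 1)
    ≈⟨ ⊕-cong (⊛-congʳ 1ₛ (X-+ 1 N)) (⊕-congʳ (X 1 ⊛ qbin N 1) (≈-sym (qbin-0 N))) ⟩
  X (suc N) ⊛ 1ₛ ⊕ (qbin N 0 ⊕ X 1 ⊛ qbin N 1) ∎
  where open ≈-Reasoning
qbin-pascal′ (suc N) (suc k) = begin
  qbin (suc N) (suc k) ⊕ X (suc (suc k)) ⊛ qbin (suc N) (suc (suc k))
    ≈⟨ ⊕-cong (qbin-pascal′ N k) (⊛-congˡ Xk2 (qbin-pascal′ N (suc k))) ⟩
  (Xa ⊛ A ⊕ B) ⊕ Xk2 ⊛ (Xb ⊛ B ⊕ C)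
    ≈⟨ solve 6 (λ xa a b xk2 xb c → (xa :* a :+ b) :+ xk2 :* (xb :* b :+ c) := (xa :* a :+ xk2 :* (xb :* b)) :+ (b :+ xk2 :* c))
             ≈-refl Xa A B Xk2 Xb C ⟩
  (Xa ⊛ A ⊕ Xk2 ⊛ (Xb ⊛ B)) ⊕ (B ⊕ Xk2 ⊛ C)
    ≈⟨ ⊕-congʳ (B ⊕ Xk2 ⊛ C) (⊕-congˡ (Xa ⊛ A)
         (≈-trans (X-merge N (suc k) B B-vanishes-or-k<N) (≈-sym (X-merge N k B weaken)))) ⟩
  (Xa ⊛ A ⊕ X (suc k) ⊛ (Xa ⊛ B)) ⊕ (B ⊕ Xk2 ⊛ C)
    ≈⟨ solve 5 (λ xa a xk1 b rest → (xa :* a :+ xk1 :* (xa :* b)) :+ rest := xa :* (a :+ xk1 :* b) :+ rest)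
             ≈-refl Xa A (X (suc k)) B (B ⊕ Xk2 ⊛ C) ⟩
  Xa ⊛ (A ⊕ X (suc k) ⊛ B) ⊕ (B ⊕ Xk2 ⊛ C) ∎
  where
  open ≈-Reasoning
  Xa = X (N ∸ k)
  Xb = X (N ∸ suc k)
  Xk2 = X (suc (suc k))
  A = qbin N k
  B = qbin N (suc k)
  C = qbin N (suc (suc k))
  B-vanishes-or-k<N = qbin-vanishes-or-≤ N (suc k)
  weaken : k ≤ N ⊎ B ≈ 0ₛ
  weaken with B-vanishes-or-k<N
  ... | inj₁ k<N = inj₁ (ℕP.<⇒≤ k<N)
  ... | inj₂ B≈0 = inj₂ B≈0

qbin-poch : ∀ N a b → a + b ≡ N → qbin N a ⊛ (poch a ⊛ poch b) ≈ poch N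
qbin-poch N zero b refl = ≈-trans (⊛-cong (qbin-0 b) (⊛-identityˡ (poch b))) (⊛-identityˡ (poch b))
qbin-poch N (suc a) zero refl =
  subst (λ M → qbin M (suc a) ⊛ (poch (suc a) ⊛ 1ₛ) ≈ poch M) (sym (ℕP.+-identityʳ (suc a)))
  (≈-trans (⊛-cong (qbin-diag (suc a)) (≈-trans (⊛-comm (poch (suc a)) 1ₛ) (⊛-identityˡ _))) (⊛-identityˡ _))
qbin-poch (suc N) (suc a) (suc b) a+b≡N = begin
  (qa ⊕ Xa ⊛ qs) ⊛ ((Fa ⊛ La) ⊛ (Fb ⊛ Lb))
    ≈⟨ solve 7 (λ qa xa qs fa la fb lb → (qa :+ xa :* qs) :* ((fa :* la) :* (fb :* lb)) :=
                   (qa :* (fa :* (fb :* lb))) :* la :+ xa :* (qs :* ((fa :* la) :* fb)) :* lb)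
             ≈-refl qa Xa qs Fa La Fb Lb ⟩
  (qa ⊛ (Fa ⊛ (Fb ⊛ Lb))) ⊛ La ⊕ Xa ⊛ (qs ⊛ ((Fa ⊛ La) ⊛ Fb)) ⊛ Lb
    ≈⟨ ⊕-cong (⊛-congʳ La (qbin-poch N a (suc b) (ℕP.suc-injective a+b≡N)))
              (⊛-congʳ Lb (⊛-congˡ Xa (qbin-poch N (suc a) b (trans (sym (ℕP.+-suc a b)) (ℕP.suc-injective a+b≡N))))) ⟩
  poch N ⊛ La ⊕ Xa ⊛ poch N ⊛ Lb
    ≈⟨ solve 3 (λ f xa xb → f :* (con (+ 1) :+ :- xa) :+ xa :* f :* (con (+ 1) :+ :- xb) := f :* (con (+ 1) :+ :- (xa :* xb)))
             ≈-refl (poch N) Xa (X (suc b)) ⟩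
  poch N ⊛ (1ₛ ⊕ ⊖ (Xa ⊛ X (suc b)))
    ≈⟨ ⊛-congˡ (poch N) (⊕-congˡ 1ₛ (⊖-cong (≈-trans (X-+ (suc a) (suc b)) (X-≡ a+b≡N)))) ⟩
  poch (suc N) ∎
  where
  open ≈-Reasoning
  qa = qbin N a
  qs = qbin N (suc a)
  Xa = X (suc a)
  Fa = poch a
  Fb = poch b
  La = [1-X] (suc a)
  Lb = [1-X] (suc b)

[1-X]-≈[]-1ₛ : ∀ M d → [1-X] (suc (M + d)) ≈[ M ] 1ₛ
[1-X]-≈[]-1ₛ M d n n≤M =
  trans (cong (λ c → 1ₛ n ℤ.- c) (X-off (suc (M + d)) n (ℕP.<⇒≢ (s≤s (ℕP.≤-trans n≤M (ℕP.m≤m+n M d))))))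
        (ℤP.+-identityʳ _)

poch-≈[] : ∀ M u → M ≤ u → poch u ≈[ M ] poch M
poch-≈[] M u M≤u = subst (λ v → poch v ≈[ M ] poch M) (ℕP.m+[n∸m]≡n M≤u) (go (u ∸ M))
  where
  go : ∀ d → poch (M + d) ≈[ M ] poch M
  go zero    = subst (λ v → poch v ≈[ M ] poch M) (sym (ℕP.+-identityʳ M)) (≈[]-refl M)
  go (suc d) = subst (λ v → poch v ≈[ M ] poch M) (sym (ℕP.+-suc M d))
    (≈[]-trans (≈[]-⊛ (go d) ([1-X]-≈[]-1ₛ M d))
               (≈⇒≈[] M (≈-trans (⊛-comm (poch M) 1ₛ) (⊛-identityˡ (poch M)))))

-- [a + b choose a] = (q)_{a+b} / ((q)_a (q)_b), and each (q)_k agrees with (q)_M up to degree M ≤ k.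
qbin-poch-≈[] : ∀ a b M → M ≤ a → M ≤ b → qbin (a + b) a ⊛ poch M ≈[ M ] 1ₛ
qbin-poch-≈[] a b M M≤a M≤b = begin
  Q ⊛ F                  ≈⟨ ≈⇒≈[] M insert-one ⟩
  (Q ⊛ (F ⊛ F)) ⊛ parts M  ≈⟨ ≈[]-⊛ Q⊛F²≈F (≈[]-refl M) ⟩
  F ⊛ parts M            ≈⟨ ≈⇒≈[] M (poch-parts M) ⟩
  1ₛ                     ∎
  where
  open ≈[]-Reasoning M
  Q = qbin (a + b) a
  F = poch M
  Q⊛F²≈F : Q ⊛ (F ⊛ F) ≈[ M ] F
  Q⊛F²≈F = ≈[]-trans (≈[]-⊛ (≈[]-refl {Q} M) (≈[]-sym (≈[]-⊛ (poch-≈[] M a M≤a) (poch-≈[] M b M≤b))))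
           (≈[]-trans (≈⇒≈[] M (qbin-poch (a + b) a b refl)) (poch-≈[] M (a + b) (ℕP.≤-trans M≤a (ℕP.m≤m+n a b))))
  insert-one : Q ⊛ F ≈ (Q ⊛ (F ⊛ F)) ⊛ parts M
  insert-one = ≈-trans
    (≈-sym (≈-trans (⊛-congˡ (Q ⊛ F) (poch-parts M)) (solve 2 (λ x y → x :* y :* con (+ 1) := x :* y) ≈-refl Q F)))
    (solve 3 (λ x y z → (x :* y) :* (y :* z) := (x :* (y :* y)) :* z) ≈-refl Q F (parts M))

-- A finite form of Jacobi's identity for ∏ (1 - qᵏ)³

tri : ℕ → ℕ
tri zero    = 0
tri (suc j) = tri j + suc j

tri-≥ : ∀ d → d ≤ tri d
tri-≥ zero    = z≤n
tri-≥ (suc d) = ℕP.m≤n+m (suc d) (tri d)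

double : ℕ → ℕ
double zero    = zero
double (suc n) = suc (suc (double n))

double≡+ : ∀ n → double n ≡ n + n
double≡+ zero    = refl
double≡+ (suc n) = cong suc (trans (cong suc (double≡+ n)) (sym (ℕP.+-suc n n)))

odd : ℕ → ℕ
odd n = suc (double n)

-- With k = i - n ∈ ℤ this is k (k - 1) / 2, the exponent of the i-th term.
triOffset : ℕ → ℕ → ℕ
triOffset n i = tri (n ∸ i) + tri (i ∸ suc n)

triOffset-left : ∀ i d → triOffset (i + d) i ≡ tri d
triOffset-left i d =
  trans (cong₂ (λ u v → tri u + tri v) (ℕP.m+n∸m≡n i d) (ℕP.m≤n⇒m∸n≡0 (ℕP.m≤n⇒m≤1+n (ℕP.m≤m+n i d))))
                           (ℕP.+-identityʳ (tri d))

triOffset-right : ∀ n d → triOffset n (suc (n + d)) ≡ tri d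
triOffset-right n d =
  cong₂ (λ u v → tri u + tri v) (ℕP.m≤n⇒m∸n≡0 (ℕP.m≤n⇒m≤1+n (ℕP.m≤m+n n d))) (ℕP.m+n∸m≡n n d)

triOffset-diag : ∀ n → triOffset n n ≡ 0
triOffset-diag n = trans (cong (λ m → triOffset m n) (sym (ℕP.+-identityʳ n))) (triOffset-left n 0)

triOffset-diag+1 : ∀ n → triOffset n (suc n) ≡ 0
triOffset-diag+1 n = trans (cong (λ i → triOffset n (suc i)) (sym (ℕP.+-identityʳ n))) (triOffset-right n 0)

triOffset-step : ∀ n i → suc i + triOffset n i ≡ suc n + triOffset n (suc i)
triOffset-step n i with compare i n
... | less i d = begin
  suc i + triOffset (suc (i + d)) i      ≡⟨ cong (λ m → suc i + triOffset m i) (sym (ℕP.+-suc i d)) ⟩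
  suc i + triOffset (i + suc d) i        ≡⟨ cong (_+_ (suc i)) (triOffset-left i (suc d)) ⟩
  suc i + (tri d + suc d)                ≡⟨ arith i d (tri d) ⟩
  suc (suc (i + d)) + tri d              ≡⟨ cong (_+_ (suc (suc (i + d)))) (sym (triOffset-left (suc i) d)) ⟩
  suc (suc (i + d)) + triOffset (suc (i + d)) (suc i) ∎
  where
  open ≡-Reasoning
  arith : ∀ i d t → suc i + (t + suc d) ≡ suc (suc (i + d)) + t
  arith = ℕSolver.solve-∀
... | equal n = cong (_+_ (suc n)) (trans (triOffset-diag n) (sym (triOffset-diag+1 n)))
... | greater n d = begin
  suc (suc (n + d)) + triOffset n (suc (n + d))    ≡⟨ cong (_+_ (suc (suc (n + d)))) (triOffset-right n d) ⟩
  suc (suc (n + d)) + tri d                        ≡⟨ arith n d (tri d) ⟩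
  suc n + (tri d + suc d)                          ≡⟨ cong (_+_ (suc n)) (sym (triOffset-right n (suc d))) ⟩
  suc n + triOffset n (suc (n + suc d))            ≡⟨ cong (λ i → suc n + triOffset n (suc i)) (ℕP.+-suc n d) ⟩
  suc n + triOffset n (suc (suc (n + d)))          ∎
  where
  open ≡-Reasoning
  arith : ∀ n d t → suc (suc (n + d)) + t ≡ suc n + (t + suc d)
  arith = ℕSolver.solve-∀

triOffset-reflect : ∀ n i → i ≤ odd n → (odd n ∸ i) + triOffset n (suc i) ≡ suc n + triOffset n i
triOffset-reflect n i i≤N with compare i n
... | less i d = begin
  (odd n′ ∸ i) + triOffset n′ (suc i)      ≡⟨ cong₂ _+_ width (triOffset-left (suc i) d) ⟩
  suc (suc n′ + d) + tri d                 ≡⟨ arith n′ d (tri d) ⟩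
  suc n′ + (tri d + suc d)                 ≡⟨ cong (_+_ (suc n′)) (sym (triOffset-left i (suc d))) ⟩
  suc n′ + triOffset (i + suc d) i         ≡⟨ cong (λ m → suc n′ + triOffset m i) (ℕP.+-suc i d) ⟩
  suc n′ + triOffset n′ i                  ∎
  where
  open ≡-Reasoning
  n′ = suc (i + d)
  width : odd n′ ∸ i ≡ suc (suc n′ + d)
  width = trans (cong (λ m → suc m ∸ i) (double≡+ n′)) (trans (cong (_∸ i) (spread i d)) (ℕP.m+n∸m≡n i _))
    where
    spread : ∀ i d → suc (suc (i + d) + suc (i + d)) ≡ i + suc (suc (suc (i + d)) + d)
    spread = ℕSolver.solve-∀
  arith : ∀ n d t → suc (suc n + d) + t ≡ suc n + (t + suc d)
  arith = ℕSolver.solve-∀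
... | equal n = begin
  (odd n ∸ n) + triOffset n (suc n)   ≡⟨ cong₂ _+_ width (triOffset-diag+1 n) ⟩
  suc n + 0                           ≡⟨ cong (_+_ (suc n)) (sym (triOffset-diag n)) ⟩
  suc n + triOffset n n               ∎
  where
  open ≡-Reasoning
  width : odd n ∸ n ≡ suc n
  width = trans (cong (λ m → suc m ∸ n) (double≡+ n))
                (trans (cong (_∸ n) (sym (ℕP.+-suc n n))) (ℕP.m+n∸m≡n n (suc n)))
... | greater n d = begin
  (odd n ∸ suc (n + d)) + triOffset n (suc (suc (n + d)))
    ≡⟨ cong₂ _+_ width (cong (λ i → triOffset n (suc i)) (sym (ℕP.+-suc n d))) ⟩
  (n ∸ d) + triOffset n (suc (n + suc d))                   ≡⟨ cong (_+_ (n ∸ d)) (triOffset-right n (suc d)) ⟩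
  (n ∸ d) + (tri d + suc d)                                 ≡⟨ arith (n ∸ d) d (tri d) ⟩
  suc ((n ∸ d) + d) + tri d                                 ≡⟨ cong (λ m → suc m + tri d) (ℕP.m∸n+n≡m d≤n) ⟩
  suc n + tri d                                             ≡⟨ cong (_+_ (suc n)) (sym (triOffset-right n d)) ⟩
  suc n + triOffset n (suc (n + d))                         ∎
  where
  open ≡-Reasoning
  width : odd n ∸ suc (n + d) ≡ n ∸ d
  width = trans (cong (λ m → suc m ∸ suc (n + d)) (double≡+ n)) (ℕP.[m+n]∸[m+o]≡n∸o n n d)
  d≤n : d ≤ n
  d≤n = ℕP.+-cancelˡ-≤ n d n (ℕP.≤-pred (subst (suc (n + d) ≤_) (cong suc (double≡+ n)) i≤N))
  arith : ∀ x d t → x + (t + suc d) ≡ suc (x + d) + t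
  arith = ℕSolver.solve-∀

triOffset-suc : ∀ n → triOffset (suc n) 0 ≡ suc n + triOffset n 0
triOffset-suc n = arith n (tri n)
  where
  arith : ∀ n t → (t + suc n) + 0 ≡ suc n + (t + 0)
  arith = ℕSolver.solve-∀

qbin-pascal² : ∀ N i → qbin (suc (suc N)) (suc (suc i)) ≈
  (1ₛ ⊕ X (suc N)) ⊛ qbin N (suc i) ⊕ X (N ∸ i) ⊛ qbin N i ⊕ X (suc (suc i)) ⊛ qbin N (suc (suc i))
qbin-pascal² N i = begin
  qbin (suc N) (suc i) ⊕ Xb ⊛ qbin (suc N) (suc (suc i))
    ≈⟨ ⊕-cong (qbin-pascal′ N i) (⊛-congˡ Xb (qbin-pascal′ N (suc i))) ⟩
  (Xa ⊛ Q₀ ⊕ Q₁) ⊕ Xb ⊛ (Xc ⊛ Q₁ ⊕ Q₂)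
    ≈⟨ solve 6 (λ xa q₀ q₁ xb xc q₂ → (xa :* q₀ :+ q₁) :+ xb :* (xc :* q₁ :+ q₂) :=
                                       (q₁ :+ xb :* (xc :* q₁)) :+ xa :* q₀ :+ xb :* q₂)
             ≈-refl Xa Q₀ Q₁ Xb Xc Q₂ ⟩
  (Q₁ ⊕ Xb ⊛ (Xc ⊛ Q₁)) ⊕ Xa ⊛ Q₀ ⊕ Xb ⊛ Q₂
    ≈⟨ ⊕-congʳ (Xb ⊛ Q₂) (⊕-congʳ (Xa ⊛ Q₀)
         (⊕-congˡ Q₁ (X-merge N (suc i) Q₁ (qbin-vanishes-or-≤ N (suc i))))) ⟩
  (Q₁ ⊕ X (suc N) ⊛ Q₁) ⊕ Xa ⊛ Q₀ ⊕ Xb ⊛ Q₂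
    ≈⟨ solve 6 (λ q₁ xₙ xa q₀ xb q₂ → (q₁ :+ xₙ :* q₁) :+ xa :* q₀ :+ xb :* q₂ :=
                                       (con (+ 1) :+ xₙ) :* q₁ :+ xa :* q₀ :+ xb :* q₂)
             ≈-refl Q₁ (X (suc N)) Xa Q₀ Xb Q₂ ⟩
  (1ₛ ⊕ X (suc N)) ⊛ Q₁ ⊕ Xa ⊛ Q₀ ⊕ Xb ⊛ Q₂ ∎
  where
  open ≈-Reasoning
  Xa = X (N ∸ i)
  Xb = X (suc (suc i))
  Xc = X (N ∸ suc i)
  Q₀ = qbin N i
  Q₁ = qbin N (suc i)
  Q₂ = qbin N (suc (suc i))

qbin-pascal²-1 : ∀ N → qbin (suc (suc N)) 1 ≈ (1ₛ ⊕ X (suc N)) ⊛ 1ₛ ⊕ X 1 ⊛ qbin N 1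
qbin-pascal²-1 N = begin
  1ₛ ⊕ X 1 ⊛ qbin (suc N) 1
    ≈⟨ ⊕-congˡ 1ₛ (⊛-congˡ (X 1)
         (≈-trans (qbin-pascal′ N 0) (⊕-congʳ (qbin N 1) (⊛-congˡ (X N) (qbin-0 N))))) ⟩
  1ₛ ⊕ X 1 ⊛ (X N ⊛ 1ₛ ⊕ qbin N 1)
    ≈⟨ solve 3 (λ x₁ xₙ q → con (+ 1) :+ x₁ :* (xₙ :* con (+ 1) :+ q) :=
                             (con (+ 1) :+ x₁ :* xₙ) :* con (+ 1) :+ x₁ :* q)
             ≈-refl (X 1) (X N) (qbin N 1) ⟩
  (1ₛ ⊕ X 1 ⊛ X N) ⊛ 1ₛ ⊕ X 1 ⊛ qbin N 1
    ≈⟨ ⊕-congʳ (X 1 ⊛ qbin N 1) (⊛-congʳ 1ₛ (⊕-congˡ 1ₛ (X-+ 1 N))) ⟩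
  (1ₛ ⊕ X (suc N)) ⊛ 1ₛ ⊕ X 1 ⊛ qbin N 1 ∎
  where open ≈-Reasoning

alt : ℕ → ℤ
alt zero    = + 1
alt (suc k) = ℤ.- alt k

jacobiTerm : ℕ → ℕ → Series
jacobiTerm n i = const (alt (i + n)) ⊛ (qbin (odd n) i ⊛ X (triOffset n i))

shift : (ℕ → Series) → ℕ → Series
shift h zero    = 0ₛ
shift h (suc i) = h i

recur : ℕ → (ℕ → Series) → ℕ → Series
recur n h i = (1ₛ ⊕ X (suc (odd n))) ⊛ shift h i ⊕ ⊖ (X (suc n) ⊛ (shift (shift h) i ⊕ h i))

recur-0 : ∀ n h → recur n h 0 ≈ ⊖ (X (suc n) ⊛ h 0)
recur-0 n h k = trans (cong₂ ℤ._+_ (⊛-zeroʳ (1ₛ ⊕ X (suc (odd n))) k)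
                                  (cong ℤ.-_ (⊛-congˡ (X (suc n)) (λ j → ℤP.+-identityˡ (h 0 j)) k)))
                      (ℤP.+-identityˡ _)

recur-1 : ∀ n h → recur n h 1 ≈ (1ₛ ⊕ X (suc (odd n))) ⊛ h 0 ⊕ ⊖ (X (suc n) ⊛ h 1)
recur-1 n h = ⊕-congˡ ((1ₛ ⊕ X (suc (odd n))) ⊛ h 0) (⊖-cong (⊛-congˡ (X (suc n)) (λ j → ℤP.+-identityˡ (h 1 j))))

jacobiTerm-recur-0 : ∀ n → jacobiTerm (suc n) 0 ≈ recur n (jacobiTerm n) 0
jacobiTerm-recur-0 n = begin
  const (ℤ.- alt n) ⊛ (1ₛ ⊛ X (triOffset (suc n) 0))
    ≈⟨ ⊛-cong (const-neg (alt n))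
              (⊛-congˡ 1ₛ (≈-trans (X-≡ (triOffset-suc n)) (≈-sym (X-+ (suc n) (triOffset n 0))))) ⟩
  (⊖ s) ⊛ (1ₛ ⊛ (Xₙ ⊛ X₀))
    ≈⟨ solve 3 (λ s xₙ x₀ → (:- s) :* (con (+ 1) :* (xₙ :* x₀)) := :- (xₙ :* (s :* (con (+ 1) :* x₀))))
             ≈-refl s Xₙ X₀ ⟩
  ⊖ (Xₙ ⊛ (s ⊛ (1ₛ ⊛ X₀)))
    ≈⟨ ≈-sym (recur-0 n (jacobiTerm n)) ⟩
  recur n (jacobiTerm n) 0 ∎
  where
  open ≈-Reasoning
  s = const (alt n)
  Xₙ = X (suc n)
  X₀ = X (triOffset n 0)

jacobiTerm-recur-1 : ∀ n → jacobiTerm (suc n) 1 ≈ recur n (jacobiTerm n) 1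
jacobiTerm-recur-1 n = begin
  const (ℤ.- ℤ.- alt n) ⊛ (qbin (suc (suc N)) 1 ⊛ X₀)
    ≈⟨ ⊛-cong (const-≡ (ℤP.neg-involutive (alt n))) (⊛-congʳ X₀ (qbin-pascal²-1 N)) ⟩
  s ⊛ (((1ₛ ⊕ X (suc N)) ⊛ 1ₛ ⊕ X 1 ⊛ Q₁) ⊛ X₀)
    ≈⟨ solve 5 (λ s c x₁ q₁ x₀ → s :* ((c :* con (+ 1) :+ x₁ :* q₁) :* x₀) :=
                                  c :* (s :* (con (+ 1) :* x₀)) :+ s :* ((x₁ :* x₀) :* q₁))
             ≈-refl s C (X 1) Q₁ X₀ ⟩
  C ⊛ (s ⊛ (1ₛ ⊛ X₀)) ⊕ s ⊛ ((X 1 ⊛ X₀) ⊛ Q₁)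
    ≈⟨ ⊕-congˡ (C ⊛ (s ⊛ (1ₛ ⊛ X₀)))
         (⊛-congˡ s (⊛-congʳ Q₁ (X-⊛-X 1 (triOffset n 0) (suc n) (triOffset n 1) (triOffset-step n 0)))) ⟩
  C ⊛ (s ⊛ (1ₛ ⊛ X₀)) ⊕ s ⊛ ((Xₙ ⊛ X₁) ⊛ Q₁)
    ≈⟨ solve 6 (λ c s x₀ xₙ x₁ q₁ → c :* (s :* (con (+ 1) :* x₀)) :+ s :* ((xₙ :* x₁) :* q₁) :=
                   c :* (s :* (con (+ 1) :* x₀)) :+ :- (xₙ :* ((:- s) :* (q₁ :* x₁))))
             ≈-refl C s X₀ Xₙ X₁ Q₁ ⟩
  C ⊛ (s ⊛ (1ₛ ⊛ X₀)) ⊕ ⊖ (Xₙ ⊛ ((⊖ s) ⊛ (Q₁ ⊛ X₁)))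
    ≈⟨ ⊕-congˡ (C ⊛ (s ⊛ (1ₛ ⊛ X₀)))
         (⊖-cong (⊛-congˡ Xₙ (⊛-congʳ (Q₁ ⊛ X₁) (≈-sym (const-neg (alt n)))))) ⟩
  C ⊛ jacobiTerm n 0 ⊕ ⊖ (Xₙ ⊛ jacobiTerm n 1)
    ≈⟨ ≈-sym (recur-1 n (jacobiTerm n)) ⟩
  recur n (jacobiTerm n) 1 ∎
  where
  open ≈-Reasoning
  N = odd n
  s = const (alt n)
  C = 1ₛ ⊕ X (suc N)
  Xₙ = X (suc n)
  X₀ = X (triOffset n 0)
  X₁ = X (triOffset n 1)
  Q₁ = qbin N 1

jacobiTerm-recur-2+ : ∀ n i → jacobiTerm (suc n) (suc (suc i)) ≈ recur n (jacobiTerm n) (suc (suc i))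
jacobiTerm-recur-2+ n i = begin
  const (alt (suc (suc i) + suc n)) ⊛ (qbin (suc (suc N)) (suc (suc i)) ⊛ X₁)
    ≈⟨ ⊛-cong (const-≡ sign) (⊛-congʳ X₁ (qbin-pascal² N i)) ⟩
  s ⊛ ((C ⊛ Q₁ ⊕ Xa ⊛ Q₀ ⊕ Xb ⊛ Q₂) ⊛ X₁)
    ≈⟨ solve 8 (λ s c q₁ xa q₀ xb q₂ x₁ → s :* ((c :* q₁ :+ xa :* q₀ :+ xb :* q₂) :* x₁) :=
                   s :* (c :* (q₁ :* x₁)) :+ s :* ((xa :* x₁) :* q₀) :+ s :* ((xb :* x₁) :* q₂))
             ≈-refl s C Q₁ Xa Q₀ Xb Q₂ X₁ ⟩
  s ⊛ (C ⊛ (Q₁ ⊛ X₁)) ⊕ s ⊛ ((Xa ⊛ X₁) ⊛ Q₀) ⊕ s ⊛ ((Xb ⊛ X₁) ⊛ Q₂)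
    ≈⟨ ⊕-cong (⊕-congˡ (s ⊛ (C ⊛ (Q₁ ⊛ X₁))) (⊛-congˡ s reflect)) (⊛-congˡ s (⊛-congʳ Q₂ step)) ⟩
  s ⊛ (C ⊛ (Q₁ ⊛ X₁)) ⊕ s ⊛ ((Xₙ ⊛ X₀) ⊛ Q₀) ⊕ s ⊛ ((Xₙ ⊛ X₂) ⊛ Q₂)
    ≈⟨ solve 9 (λ s c q₁ x₁ xₙ x₀ q₀ x₂ q₂ →
                   s :* (c :* (q₁ :* x₁)) :+ s :* ((xₙ :* x₀) :* q₀) :+ s :* ((xₙ :* x₂) :* q₂) :=
                   c :* (s :* (q₁ :* x₁)) :+ :- (xₙ :* ((:- s) :* (q₀ :* x₀) :+ (:- s) :* (q₂ :* x₂))))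
             ≈-refl s C Q₁ X₁ Xₙ X₀ Q₀ X₂ Q₂ ⟩
  C ⊛ (s ⊛ (Q₁ ⊛ X₁)) ⊕ ⊖ (Xₙ ⊛ ((⊖ s) ⊛ (Q₀ ⊛ X₀) ⊕ (⊖ s) ⊛ (Q₂ ⊛ X₂)))
    ≈⟨ ⊕-congˡ (C ⊛ (s ⊛ (Q₁ ⊛ X₁))) (⊖-cong (⊛-congˡ Xₙ (⊕-cong (⊛-congʳ (Q₀ ⊛ X₀) ⊖s≈s′)
                                                            (⊛-congʳ (Q₂ ⊛ X₂) (≈-sym (const-neg σ)))))) ⟩
  recur n (jacobiTerm n) (suc (suc i)) ∎
  where
  open ≈-Reasoning
  N = odd n
  σ = alt (suc i + n)
  s = const σ
  C = 1ₛ ⊕ X (suc N)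
  Xₙ = X (suc n)
  Xa = X (N ∸ i)
  Xb = X (suc (suc i))
  X₀ = X (triOffset n i)
  X₁ = X (triOffset n (suc i))
  X₂ = X (triOffset n (suc (suc i)))
  Q₀ = qbin N i
  Q₁ = qbin N (suc i)
  Q₂ = qbin N (suc (suc i))
  sign : alt (suc (suc i) + suc n) ≡ σ
  sign = trans (ℤP.neg-involutive (alt (i + suc n))) (cong alt (ℕP.+-suc i n))
  ⊖s≈s′ : ⊖ s ≈ const (alt (i + n))
  ⊖s≈s′ = ≈-trans (≈-sym (const-neg σ)) (const-≡ (ℤP.neg-involutive (alt (i + n))))
  step : Xb ⊛ X₁ ≈ Xₙ ⊛ X₂
  step = X-⊛-X (suc (suc i)) (triOffset n (suc i)) (suc n) (triOffset n (suc (suc i))) (triOffset-step n (suc i))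
  reflect : (Xa ⊛ X₁) ⊛ Q₀ ≈ (Xₙ ⊛ X₀) ⊛ Q₀
  reflect with qbin-vanishes-or-≤ N i
  ... | inj₁ i≤N = ⊛-congʳ Q₀ (X-⊛-X (N ∸ i) (triOffset n (suc i)) (suc n) (triOffset n i) (triOffset-reflect n i i≤N))
  ... | inj₂ Q₀≈0 = ≈-trans (⊛-congˡ (Xa ⊛ X₁) Q₀≈0) (≈-trans (⊛-zeroʳ _)
                      (≈-trans (≈-sym (⊛-zeroʳ _)) (⊛-congˡ (Xₙ ⊛ X₀) (≈-sym Q₀≈0))))

jacobiTerm-recur : ∀ n i → jacobiTerm (suc n) i ≈ recur n (jacobiTerm n) i
jacobiTerm-recur n zero          = jacobiTerm-recur-0 n
jacobiTerm-recur n (suc zero)    = jacobiTerm-recur-1 n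
jacobiTerm-recur n (suc (suc i)) = jacobiTerm-recur-2+ n i

∑ₛ-shift : ∀ M h → ∑ₛ< (suc M) (shift h) ≈ ∑ₛ< M h
∑ₛ-shift M h k = ℤP.+-identityˡ _

shift-cong : ∀ {h h′} → (∀ i → h i ≈ h′ i) → ∀ i → shift h i ≈ shift h′ i
shift-cong h≈h′ zero    = ≈-refl
shift-cong h≈h′ (suc i) = h≈h′ i

partial : (ℕ → Series) → ℕ → Series
partial h j = ∑ₛ< (suc j) h

partial-shift : ∀ h j → partial (shift h) j ≈ shift (partial h) j
partial-shift h zero    _ = refl
partial-shift h (suc j)   = ∑ₛ-shift (suc j) h

∑ₛ-recur : ∀ M n h → ∑ₛ< M (recur n h) ≈
  (1ₛ ⊕ X (suc (odd n))) ⊛ ∑ₛ< M (shift h) ⊕ ⊖ (X (suc n) ⊛ (∑ₛ< M (shift (shift h)) ⊕ ∑ₛ< M h))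
∑ₛ-recur M n h = begin
  ∑ₛ[ i < M ] (C ⊛ shift h i ⊕ ⊖ (Xₙ ⊛ (shift (shift h) i ⊕ h i)))
    ≈⟨ ∑ₛ-distrib-⊕ M (λ i → C ⊛ shift h i) (λ i → ⊖ (Xₙ ⊛ (shift (shift h) i ⊕ h i))) ⟩
  (∑ₛ[ i < M ] C ⊛ shift h i) ⊕ (∑ₛ[ i < M ] ⊖ (Xₙ ⊛ (shift (shift h) i ⊕ h i)))
    ≈⟨ ⊕-cong (≈-sym (⊛-∑ₛ M C (shift h))) (∑ₛ-⊖ M (λ i → Xₙ ⊛ (shift (shift h) i ⊕ h i))) ⟩
  C ⊛ ∑ₛ< M (shift h) ⊕ ⊖ (∑ₛ[ i < M ] Xₙ ⊛ (shift (shift h) i ⊕ h i))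
    ≈⟨ ⊕-congˡ (C ⊛ ∑ₛ< M (shift h))
         (⊖-cong (≈-trans (≈-sym (⊛-∑ₛ M Xₙ (λ i → shift (shift h) i ⊕ h i)))
                                                     (⊛-congˡ Xₙ (∑ₛ-distrib-⊕ M (shift (shift h)) h)))) ⟩
  C ⊛ ∑ₛ< M (shift h) ⊕ ⊖ (Xₙ ⊛ (∑ₛ< M (shift (shift h)) ⊕ ∑ₛ< M h)) ∎
  where
  open ≈-Reasoning
  C = 1ₛ ⊕ X (suc (odd n))
  Xₙ = X (suc n)

partial-recur : ∀ n h j → partial (recur n h) j ≈ recur n (partial h) j
partial-recur n h j = ≈-trans (∑ₛ-recur (suc j) n h)
  (⊕-cong (⊛-congˡ (1ₛ ⊕ X (suc (odd n))) (partial-shift h j))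
          (⊖-cong (⊛-congˡ (X (suc n)) (⊕-congʳ (partial h j)
            (≈-trans (partial-shift (shift h) j) (shift-cong (partial-shift h) j))))))

jacobiPartial : ℕ → ℕ → Series
jacobiPartial n = partial (jacobiTerm n)

jacobiPartial-recur : ∀ n j → jacobiPartial (suc n) j ≈ recur n (jacobiPartial n) j
jacobiPartial-recur n j =
  ≈-trans (∑ₛ-cong (suc j) (λ i _ → jacobiTerm-recur n i)) (partial-recur n (jacobiTerm n) j)

jacobiTerm-0-0 : jacobiTerm 0 0 ≈ 1ₛ
jacobiTerm-0-0 = ≈-trans (⊛-identityˡ (1ₛ ⊛ X 0)) (≈-trans (⊛-identityˡ (X 0)) X-zero)

-- The full sum vanishes: it is the q-binomial expansion of a product containing the factor 1 - q⁰.
jacobiPartial-vanishes : ∀ n j → odd n ≤ j → jacobiPartial n j ≈ 0ₛ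
jacobiPartial-vanishes zero (suc zero) _ = begin
  jacobiTerm 0 0 ⊕ (jacobiTerm 0 1 ⊕ 0ₛ)
    ≈⟨ ⊕-cong jacobiTerm-0-0 (λ k → ℤP.+-identityʳ _) ⟩
  1ₛ ⊕ jacobiTerm 0 1
    ≈⟨ ⊕-congˡ 1ₛ (⊛-cong (const-neg (+ 1)) (⊛-cong (qbin-diag 1) X-zero)) ⟩
  1ₛ ⊕ (⊖ 1ₛ) ⊛ (1ₛ ⊛ 1ₛ)
    ≈⟨ solve 0 (con (+ 1) :+ (:- con (+ 1)) :* (con (+ 1) :* con (+ 1)) := con (+ 0)) ≈-refl ⟩
  const (+ 0)
    ≈⟨ (λ { zero → refl ; (suc k) → refl }) ⟩
  0ₛ ∎
  where open ≈-Reasoning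
jacobiPartial-vanishes zero (suc (suc j)) _ = begin
  jacobiPartial 0 (suc (suc j))
    ≈⟨ ∑ₛ-snoc (suc (suc j)) (jacobiTerm 0) ⟩
  jacobiPartial 0 (suc j) ⊕ jacobiTerm 0 (suc (suc j))
    ≈⟨ ⊕-cong (jacobiPartial-vanishes zero (suc j) (s≤s z≤n))
              (≈-trans (⊛-congˡ (const (alt (suc (suc j) + 0)))
                                 (⊛-congʳ (X (triOffset 0 (suc (suc j)))) (qbin-above 1 (suc (suc j)) (s≤s (s≤s z≤n)))))
                       (≈-trans (⊛-congˡ (const (alt (suc (suc j) + 0))) (⊛-zeroˡ _)) (⊛-zeroʳ _))) ⟩
  0ₛ ⊕ 0ₛ
    ≈⟨ (λ k → refl) ⟩
  0ₛ ∎
  where open ≈-Reasoning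
jacobiPartial-vanishes (suc n) (suc (suc j)) (s≤s (s≤s N≤j)) = begin
  jacobiPartial (suc n) (suc (suc j))
    ≈⟨ jacobiPartial-recur n (suc (suc j)) ⟩
  C ⊛ P (suc j) ⊕ ⊖ (X (suc n) ⊛ (P j ⊕ P (suc (suc j))))
    ≈⟨ ⊕-cong (⊛-congˡ C (jacobiPartial-vanishes n (suc j) (ℕP.m≤n⇒m≤1+n N≤j)))
              (⊖-cong (⊛-congˡ (X (suc n)) (⊕-cong (jacobiPartial-vanishes n j N≤j)
                 (jacobiPartial-vanishes n (suc (suc j)) (ℕP.m≤n⇒m≤1+n (ℕP.m≤n⇒m≤1+n N≤j)))))) ⟩
  C ⊛ 0ₛ ⊕ ⊖ (X (suc n) ⊛ (0ₛ ⊕ 0ₛ))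
    ≈⟨ (λ k → cong₂ ℤ._+_ (⊛-zeroʳ C k) (cong ℤ.-_ (⊛-zeroʳ (X (suc n)) k))) ⟩
  0ₛ ∎
  where
  open ≈-Reasoning
  C = 1ₛ ⊕ X (suc (odd n))
  P = jacobiPartial n

jacobiWeighted : ℕ → Series
jacobiWeighted n = ∑ₛ< (odd n) (jacobiPartial n)

jacobiWeighted-recur : ∀ n → jacobiWeighted (suc n) ≈ ([1-X] (suc n) ⊛ [1-X] (suc n)) ⊛ jacobiWeighted n
jacobiWeighted-recur n = begin
  ∑ₛ< (suc (suc N)) (jacobiPartial (suc n))
    ≈⟨ ∑ₛ-cong (suc (suc N)) (λ j _ → jacobiPartial-recur n j) ⟩
  ∑ₛ< (suc (suc N)) (recur n P)
    ≈⟨ ∑ₛ-recur (suc (suc N)) n P ⟩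
  C ⊛ ∑ₛ< (suc (suc N)) (shift P) ⊕ ⊖ (Xₙ ⊛ (∑ₛ< (suc (suc N)) (shift (shift P)) ⊕ ∑ₛ< (suc (suc N)) P))
    ≈⟨ ⊕-cong (⊛-congˡ C (≈-trans (∑ₛ-shift (suc N) P) (drop 1)))
              (⊖-cong (⊛-congˡ Xₙ (⊕-cong (≈-trans (∑ₛ-shift (suc N) (shift P)) (∑ₛ-shift N P)) (drop 2)))) ⟩
  C ⊛ S ⊕ ⊖ (Xₙ ⊛ (S ⊕ S))
    ≈⟨ ⊕-congʳ (⊖ (Xₙ ⊛ (S ⊕ S)))
         (⊛-congʳ S (⊕-congˡ 1ₛ (≈-trans (X-≡ (double≡+ (suc n))) (≈-sym (X-+ (suc n) (suc n)))))) ⟩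
  (1ₛ ⊕ Xₙ ⊛ Xₙ) ⊛ S ⊕ ⊖ (Xₙ ⊛ (S ⊕ S))
    ≈⟨ solve 2 (λ x s → (con (+ 1) :+ x :* x) :* s :+ :- (x :* (s :+ s)) := ((con (+ 1) :+ :- x) :* (con (+ 1) :+ :- x)) :* s)
             ≈-refl Xₙ S ⟩
  ([1-X] (suc n) ⊛ [1-X] (suc n)) ⊛ S ∎
  where
  open ≈-Reasoning
  N = odd n
  P = jacobiPartial n
  S = jacobiWeighted n
  C = 1ₛ ⊕ X (suc N)
  Xₙ = X (suc n)
  drop : ∀ d → ∑ₛ< (d + N) P ≈ S
  drop d = ≈-trans (λ k → cong (λ m → ∑ₛ< m P k) (ℕP.+-comm d N)) (∑ₛ-vanishing N d P (jacobiPartial-vanishes n))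

jacobiWeighted-poch : ∀ n → jacobiWeighted n ≈ poch n ⊛ poch n
jacobiWeighted-poch zero    k = trans (ℤP.+-identityʳ _) (trans (ℤP.+-identityʳ _)
                                  (trans (jacobiTerm-0-0 k) (sym (⊛-identityˡ 1ₛ k))))
jacobiWeighted-poch (suc n) = begin
  jacobiWeighted (suc n)      ≈⟨ jacobiWeighted-recur n ⟩
  (L ⊛ L) ⊛ jacobiWeighted n  ≈⟨ ⊛-congˡ (L ⊛ L) (jacobiWeighted-poch n) ⟩
  (L ⊛ L) ⊛ (poch n ⊛ poch n) ≈⟨ solve 2 (λ l f → (l :* l) :* (f :* f) := (f :* l) :* (f :* l)) ≈-refl L (poch n) ⟩
  poch (suc n) ⊛ poch (suc n) ∎
  where
  open ≈-Reasoning
  L = [1-X] (suc n)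

∑-partials : ∀ B (f : ℕ → ℤ) → ∑[ i < B ] ∑< (suc i) f ≡ ∑[ l < B ] + (B ∸ l) ℤ.* f l
∑-partials zero    f = refl
∑-partials (suc B) f = begin
  ∑[ i < suc B ] ∑< (suc i) f
    ≡⟨ ∑-snoc B (λ i → ∑< (suc i) f) ⟩
  (∑[ i < B ] ∑< (suc i) f) ℤ.+ ∑< (suc B) f
    ≡⟨ cong₂ ℤ._+_ (∑-partials B f) (∑-snoc B f) ⟩
  (∑[ l < B ] + (B ∸ l) ℤ.* f l) ℤ.+ (∑< B f ℤ.+ f B)
    ≡⟨ regroup (∑[ l < B ] + (B ∸ l) ℤ.* f l) (∑< B f) (f B) ⟩
  ((∑[ l < B ] + (B ∸ l) ℤ.* f l) ℤ.+ ∑< B f) ℤ.+ + 1 ℤ.* f B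
    ≡⟨ cong₂ ℤ._+_ (sym (∑-distrib-+ B (λ l → + (B ∸ l) ℤ.* f l) f))
                   (cong (λ c → + c ℤ.* f B) (sym (ℕP.m+n∸n≡m 1 B))) ⟩
  (∑[ l < B ] (+ (B ∸ l) ℤ.* f l ℤ.+ f l)) ℤ.+ + (suc B ∸ B) ℤ.* f B
    ≡⟨ cong (ℤ._+ + (suc B ∸ B) ℤ.* f B) (∑-cong B (λ l l<B → trans (one-more (+ (B ∸ l)) (f l))
           (cong (λ c → + c ℤ.* f l) (sym (ℕP.+-∸-assoc 1 (ℕP.<⇒≤ l<B)))))) ⟩
  (∑[ l < B ] + (suc B ∸ l) ℤ.* f l) ℤ.+ + (suc B ∸ B) ℤ.* f B
    ≡⟨ sym (∑-snoc B (λ l → + (suc B ∸ l) ℤ.* f l)) ⟩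
  ∑[ l < suc B ] + (suc B ∸ l) ℤ.* f l ∎
  where
  open ≡-Reasoning
  regroup : ∀ x y z → x ℤ.+ (y ℤ.+ z) ≡ (x ℤ.+ y) ℤ.+ + 1 ℤ.* z
  regroup = solve-∀
  one-more : ∀ w v → w ℤ.* v ℤ.+ v ≡ (+ 1 ℤ.+ w) ℤ.* v
  one-more = solve-∀

jacobiWeighted-as-∑ : ∀ n → jacobiWeighted n ≈ ∑ₛ[ l < odd n ] + (odd n ∸ l) ⋆ jacobiTerm n l
jacobiWeighted-as-∑ n k = ∑-partials (odd n) (λ l → jacobiTerm n l k)

X⊛qbin⊛poch-≈[] : ∀ e N l n M → l ≤ N → M ≤ l → M ≤ N ∸ l → M ≤ n → n ≤ e + M →
                  X e ⊛ (qbin N l ⊛ poch n) ≈[ n ] X e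
X⊛qbin⊛poch-≈[] e N l n M l≤N M≤l M≤N-l M≤n n≤e+M = begin
  X e ⊛ (qbin N l ⊛ poch n)  ≈⟨ ≈[]-weaken n≤e+M (X⊛-≈[] e qbin⊛poch≈1) ⟩
  X e ⊛ 1ₛ                   ≈⟨ ≈⇒≈[] n (≈-trans (⊛-comm (X e) 1ₛ) (⊛-identityˡ (X e))) ⟩
  X e                        ∎
  where
  open ≈[]-Reasoning n
  qbin⊛poch≈1 : qbin N l ⊛ poch n ≈[ M ] 1ₛ
  qbin⊛poch≈1 = ≈[]-trans (≈[]-⊛ (≈[]-refl {qbin N l} M) (poch-≈[] M n M≤n))
    (subst (λ K → qbin K l ⊛ poch M ≈[ M ] 1ₛ) (ℕP.m+[n∸m]≡n l≤N) (qbin-poch-≈[] l (N ∸ l) M M≤l M≤N-l))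

-- qbin-poch-≈[] applies with M = min(l, 2n + 1 - l), and triOffset n l + M ≥ n.
jacobiTerm-poch-≈[] : ∀ n l → l < odd n → X (triOffset n l) ⊛ (qbin (odd n) l ⊛ poch n) ≈[ n ] X (triOffset n l)
jacobiTerm-poch-≈[] n l l<N with l ℕ.≤? n
... | yes l≤n = X⊛qbin⊛poch-≈[] (triOffset n l) N l n l (ℕP.<⇒≤ l<N) ℕP.≤-refl l≤N-l l≤n n≤e+l
  where
  N = odd n
  l≤N-l : l ≤ N ∸ l
  l≤N-l = ℕP.m+n≤o⇒m≤o∸n l (ℕP.≤-trans (ℕP.+-mono-≤ l≤n l≤n)
                                       (ℕP.≤-trans (ℕP.≤-reflexive (sym (double≡+ n))) (ℕP.n≤1+n (double n))))
  n≤e+l : n ≤ triOffset n l + l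
  n≤e+l = subst (_≤ triOffset n l + l) (ℕP.m∸n+n≡m l≤n)
            (ℕP.+-monoˡ-≤ l (ℕP.≤-trans (tri-≥ (n ∸ l)) (ℕP.m≤m+n (tri (n ∸ l)) _)))
... | no l≰n with compare l n
...   | less _ _    = ⊥-elim (l≰n (ℕP.m≤n⇒m≤1+n (ℕP.m≤m+n l _)))
...   | equal _     = ⊥-elim (l≰n ℕP.≤-refl)
...   | greater _ d = X⊛qbin⊛poch-≈[] (triOffset n l) N l n (n ∸ d) (ℕP.<⇒≤ l<N) M≤l (ℕP.≤-reflexive (sym width))
                                      (ℕP.m∸n≤m n d) n≤e+M
  where
  N = odd n
  width : N ∸ l ≡ n ∸ d
  width = trans (cong (λ m → suc m ∸ l) (double≡+ n)) (ℕP.[m+n]∸[m+o]≡n∸o n n d)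
  M≤l : n ∸ d ≤ l
  M≤l = ℕP.≤-trans (ℕP.m∸n≤m n d) (ℕP.m≤n⇒m≤1+n (ℕP.m≤m+n n d))
  d≤n : d ≤ n
  d≤n = ℕP.+-cancelˡ-≤ n d n (ℕP.<⇒≤ (ℕP.≤-pred (subst (l <_) (cong suc (double≡+ n)) l<N)))
  n≤e+M : n ≤ triOffset n l + (n ∸ d)
  n≤e+M = subst (_≤ triOffset n l + (n ∸ d)) (trans (ℕP.+-comm d (n ∸ d)) (ℕP.m∸n+n≡m d≤n))
            (ℕP.+-monoˡ-≤ (n ∸ d) (subst (d ≤_) (sym (triOffset-right n d)) (tri-≥ d)))

weightedSum : ℕ → Series
weightedSum n = ∑ₛ[ l < odd n ] (+ (odd n ∸ l) ℤ.* alt (l + n)) ⋆ X (triOffset n l)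

poch³-≈[]-weightedSum : ∀ n → poch n ^ 3 ≈[ n ] weightedSum n
poch³-≈[]-weightedSum n = begin
  poch n ^ 3
    ≈⟨ ≈⇒≈[] n (solve 1 (λ f → f :^ 3 := f :* (f :* f)) ≈-refl (poch n)) ⟩
  poch n ⊛ (poch n ⊛ poch n)
    ≈⟨ ≈⇒≈[] n (⊛-congˡ (poch n) (≈-trans (≈-sym (jacobiWeighted-poch n)) (jacobiWeighted-as-∑ n))) ⟩
  poch n ⊛ (∑ₛ[ l < N ] w l ⋆ jacobiTerm n l)
    ≈⟨ ≈⇒≈[] n (≈-trans (⊛-∑ₛ N (poch n) (λ l → w l ⋆ jacobiTerm n l))
                        (∑ₛ-cong N (λ l _ → rearrange l))) ⟩
  ∑ₛ[ l < N ] w l ⋆ (const (σ l) ⊛ (X (e l) ⊛ (qbin N l ⊛ poch n)))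
    ≈⟨ ≈[]-∑ₛ N (λ l l<N → ≈[]-⋆ (w l) (≈[]-⊛ (≈[]-refl {const (σ l)} n) (jacobiTerm-poch-≈[] n l l<N))) ⟩
  ∑ₛ[ l < N ] w l ⋆ (const (σ l) ⊛ X (e l))
    ≈⟨ ≈⇒≈[] n (∑ₛ-cong N (λ l _ k →
         trans (cong (w l ℤ.*_) (const-⊛ (σ l) (X (e l)) k)) (sym (ℤP.*-assoc (w l) (σ l) _)))) ⟩
  weightedSum n ∎
  where
  open ≈[]-Reasoning n
  N = odd n
  w = λ l → + (N ∸ l)
  σ = λ l → alt (l + n)
  e = triOffset n
  rearrange : ∀ l → poch n ⊛ (w l ⋆ jacobiTerm n l) ≈ w l ⋆ (const (σ l) ⊛ (X (e l) ⊛ (qbin N l ⊛ poch n)))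
  rearrange l = ≈-trans (⊛-⋆-comm (w l) (poch n) (jacobiTerm n l)) (λ k → cong (w l ℤ.*_)
    (solve 4 (λ f s q x → f :* (s :* (q :* x)) := s :* (x :* (q :* f))) ≈-refl (poch n) (const (σ l)) (qbin N l) (X (e l)) k))

alt-+ : ∀ a b → alt (a + b) ≡ alt a ℤ.* alt b
alt-+ zero    b = sym (ℤP.*-identityˡ (alt b))
alt-+ (suc a) b = trans (cong ℤ.-_ (alt-+ a b)) (ℤP.neg-distribˡ-* (alt a) (alt b))

alt-square : ∀ a → alt a ℤ.* alt a ≡ + 1
alt-square zero    = refl
alt-square (suc a) = trans (neg-square (alt a)) (alt-square a)
  where
  neg-square : ∀ x → ℤ.- x ℤ.* ℤ.- x ≡ x ℤ.* x
  neg-square = solve-∀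

jacobiMonomial : ℕ → Series
jacobiMonomial j = (alt j ℤ.* + odd j) ⋆ X (tri j)

jacobi : ℕ → Series
jacobi n = ∑ₛ[ j < suc n ] jacobiMonomial j

alt-even : ∀ a b → alt ((a + a) + b) ≡ alt b
alt-even a b = trans (alt-+ (a + a) b) (trans (cong (ℤ._* alt b) (trans (alt-+ a a) (alt-square a))) (ℤP.*-identityˡ (alt b)))

weightedCoeff : ℕ → ℕ → ℕ → ℤ
weightedCoeff n m l = (+ (odd n ∸ l) ℤ.* alt (l + n)) ℤ.* X (triOffset n l) m

-- In weightedSum n with n = k + j, the terms l = n - j and l = n + 1 + j both have exponent tri j.
weightedCoeff-pair : ∀ k j m → weightedCoeff (k + j) m k ℤ.+ weightedCoeff (k + j) m (suc (k + j) + j) ≡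
                               (alt j ℤ.* + odd j) ℤ.* X (tri j) m
weightedCoeff-pair k j m = begin
  (+ (N ∸ k) ℤ.* alt (k + n)) ℤ.* X (triOffset n k) m ℤ.+
  (+ (N ∸ suc (n + j)) ℤ.* alt (suc (n + j) + n)) ℤ.* X (triOffset n (suc (n + j))) m
    ≡⟨ cong₂ (λ u v → (+ (N ∸ k) ℤ.* alt (k + n)) ℤ.* X u m ℤ.+
                      (+ (N ∸ suc (n + j)) ℤ.* alt (suc (n + j) + n)) ℤ.* X v m)
             (triOffset-left k j) (triOffset-right n j) ⟩
  (+ (N ∸ k) ℤ.* alt (k + n)) ℤ.* X (tri j) m ℤ.+ (+ (N ∸ suc (n + j)) ℤ.* alt (suc (n + j) + n)) ℤ.* X (tri j) m
    ≡⟨ cong₂ (λ u v → u ℤ.* X (tri j) m ℤ.+ v ℤ.* X (tri j) m)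
             (cong₂ (λ w s → + w ℤ.* s) w₁ s₁) (cong₂ (λ w s → + w ℤ.* s) w₂ s₂) ⟩
  (+ (k + suc (j + j)) ℤ.* alt j) ℤ.* X (tri j) m ℤ.+ (+ k ℤ.* ℤ.- alt j) ℤ.* X (tri j) m
    ≡⟨ cong (λ c → (c ℤ.* alt j) ℤ.* X (tri j) m ℤ.+ (+ k ℤ.* ℤ.- alt j) ℤ.* X (tri j) m)
            (ℤP.pos-+ k (suc (j + j))) ⟩
  ((+ k ℤ.+ + suc (j + j)) ℤ.* alt j) ℤ.* X (tri j) m ℤ.+ (+ k ℤ.* ℤ.- alt j) ℤ.* X (tri j) m
    ≡⟨ cancel (+ k) (+ suc (j + j)) (alt j) (X (tri j) m) ⟩
  (alt j ℤ.* + suc (j + j)) ℤ.* X (tri j) m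
    ≡⟨ cong (λ d → (alt j ℤ.* + suc d) ℤ.* X (tri j) m) (sym (double≡+ j)) ⟩
  (alt j ℤ.* + odd j) ℤ.* X (tri j) m ∎
  where
  open ≡-Reasoning
  n = k + j
  N = odd n
  w₁ : N ∸ k ≡ k + suc (j + j)
  w₁ = trans (cong (λ t → suc t ∸ k) (double≡+ n)) (trans (cong (_∸ k) (spread k j)) (ℕP.m+n∸m≡n k _))
    where
    spread : ∀ k j → suc ((k + j) + (k + j)) ≡ k + (k + suc (j + j))
    spread = ℕSolver.solve-∀
  w₂ : N ∸ suc (n + j) ≡ k
  w₂ = trans (cong (λ t → suc t ∸ suc (n + j)) (double≡+ n)) (trans (ℕP.[m+n]∸[m+o]≡n∸o n n j) (ℕP.m+n∸n≡m k j))
  s₁ : alt (k + n) ≡ alt j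
  s₁ = trans (cong alt (sym (ℕP.+-assoc k k j))) (alt-even k j)
  s₂ : alt (suc (n + j) + n) ≡ ℤ.- alt j
  s₂ = cong ℤ.-_ (trans (cong alt (swap n j)) (alt-even n j))
    where
    swap : ∀ n j → (n + j) + n ≡ (n + n) + j
    swap = ℕSolver.solve-∀
  cancel : ∀ K S a x → ((K ℤ.+ S) ℤ.* a) ℤ.* x ℤ.+ (K ℤ.* ℤ.- a) ℤ.* x ≡ (a ℤ.* S) ℤ.* x
  cancel = solve-∀

weightedSum≈jacobi : ∀ n → weightedSum n ≈ jacobi n
weightedSum≈jacobi n m = begin
  ∑< N f
    ≡⟨ sym (trans (∑-snoc N f) (trans (cong (ℤ._+_ (∑< N f)) last-vanishes) (ℤP.+-identityʳ _))) ⟩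
  ∑< (suc N) f
    ≡⟨ cong (λ M → ∑< M f) (double≡+ (suc n)) ⟩
  ∑< (suc n + suc n) f
    ≡⟨ ∑-split (suc n) (suc n) f ⟩
  ∑< (suc n) f ℤ.+ (∑[ j < suc n ] f (suc n + j))
    ≡⟨ cong (ℤ._+ (∑[ j < suc n ] f (suc n + j))) (∑-reverse (suc n) f) ⟩
  (∑[ j < suc n ] f (n ∸ j)) ℤ.+ (∑[ j < suc n ] f (suc n + j))
    ≡⟨ sym (∑-distrib-+ (suc n) (λ j → f (n ∸ j)) (λ j → f (suc n + j))) ⟩
  ∑[ j < suc n ] (f (n ∸ j) ℤ.+ f (suc n + j))
    ≡⟨ ∑-cong (suc n) (λ j j<1+n → pair (n ∸ j) j n (ℕP.m∸n+n≡m (ℕP.≤-pred j<1+n))) ⟩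
  jacobi n m ∎
  where
  open ≡-Reasoning
  N = odd n
  f = weightedCoeff n m
  last-vanishes : f N ≡ + 0
  last-vanishes = cong (λ w → (+ w ℤ.* alt (N + n)) ℤ.* X (triOffset n N) m) (ℕP.n∸n≡0 N)
  pair : ∀ k j n → k + j ≡ n →
         weightedCoeff n m k ℤ.+ weightedCoeff n m (suc n + j) ≡ (alt j ℤ.* + odd j) ℤ.* X (tri j) m
  pair k j _ refl = weightedCoeff-pair k j m

poch³-≈[]-jacobi : ∀ n → poch n ^ 3 ≈[ n ] jacobi n
poch³-≈[]-jacobi n = ≈[]-trans (poch³-≈[]-weightedSum n) (≈⇒≈[] n (weightedSum≈jacobi n))

-- Ramanujan's congruence p(5n + 4) ≡ 0 (mod 5)

[1-X]^5 : ∀ s → [1-X] s ^ 5 ≈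
  (1ₛ ⊕ ⊖ (X s ^ 5)) ⊕ const (+ 5) ⊛ (⊖ X s ⊕ const (+ 2) ⊛ X s ^ 2 ⊕ ⊖ (const (+ 2) ⊛ X s ^ 3) ⊕ X s ^ 4)
[1-X]^5 s = solve 1 (λ x → (con (+ 1) :+ :- x) :^ 5 :=
  (con (+ 1) :+ :- (x :^ 5)) :+ con (+ 5) :* (:- x :+ con (+ 2) :* x :^ 2 :+ :- (con (+ 2) :* x :^ 3) :+ x :^ 4)) ≈-refl (X s)

InQᵐ-[1-X]^5 : ∀ s → InQᵐ ([1-X] s ^ 5)
InQᵐ-[1-X]^5 s = InQᵐ-resp-≈ (≈-sym ([1-X]^5 s))
  (InQᵐ-⊕ (InQᵐ-⊕ (InClass⇒InQᵐ InClass-1ₛ) (InQᵐ-⊖ (InClass⇒InQᵐ X^5∈0))) (InQᵐ-m⊛ _))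
  where
  X^5∈0 : InClass 0 (X s ^ 5)
  X^5∈0 = InClass-resp-≈ {0} (≈-sym (X-^ s 5))
            (InClass-resp-≋ {5 * s} {0} (trans (cong (_% 5) (ℕP.*-comm 5 s)) (m*n%n≡0 s 5)) (InClass-X (5 * s)))

poch-0 : ∀ k → poch k 0 ≡ + 1
poch-0 zero    = refl
poch-0 (suc k) = cong (ℤ._* + 1) (poch-0 k)

InQᵐ-poch^5 : ∀ k → InQᵐ (poch k ^ 5)
InQᵐ-poch^5 zero    = InQᵐ-resp-≈ (≈-sym (1ₛ-^ 5)) (InClass⇒InQᵐ InClass-1ₛ)
InQᵐ-poch^5 (suc k) = InQᵐ-resp-≈ (≈-sym (^-distrib-* (poch k) ([1-X] (suc k)) 5))
                                  (InQᵐ-⊛ (InQᵐ-poch^5 k) (InQᵐ-[1-X]^5 (suc k)))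

InQᵐ-parts^5 : ∀ k → InQᵐ (parts k ^ 5)
InQᵐ-parts^5 k = InQᵐ-inverse inverse (^-const-term (poch k) 5 (poch-0 k)) (InQᵐ-poch^5 k)
  where
  inverse : poch k ^ 5 ⊛ parts k ^ 5 ≈ 1ₛ
  inverse = ≈-trans (≈-sym (^-distrib-* (poch k) (parts k) 5)) (≈-trans (^-congˡ 5 (poch-parts k)) (1ₛ-^ 5))

parts-decomposition : ∀ k → parts k ≈ poch k ^ 24 ⊛ (parts k ^ 5) ^ 5
parts-decomposition k = begin
  parts k                         ≈⟨ ≈-sym (⊛-identityˡ (parts k)) ⟩
  1ₛ ⊛ parts k                    ≈⟨ ⊛-congʳ (parts k) (≈-sym (≈-trans (^-congˡ 24 (poch-parts k)) (1ₛ-^ 24))) ⟩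
  (F ⊛ P) ^ 24 ⊛ P                ≈⟨ ⊛-congʳ P (^-distrib-* F P 24) ⟩
  (F ^ 24 ⊛ P ^ 24) ⊛ P           ≈⟨ ⊛-assoc (F ^ 24) (P ^ 24) P ⟩
  F ^ 24 ⊛ (P ^ 24 ⊛ P)           ≈⟨ ⊛-congˡ (F ^ 24) (≈-trans (⊛-comm (P ^ 24) P) (≈-sym (^-assocʳ P 5 5))) ⟩
  F ^ 24 ⊛ (P ^ 5) ^ 5            ∎
  where
  open ≈-Reasoning
  F = poch k
  P = parts k

tri-periodic : ∀ j → tri (5 + j) ≋ tri j
tri-periodic j = trans (cong (_% 5) (expand (tri j) j)) ([m+kn]%n≡m%n (tri j) (j + 3) 5)
  where
  expand : ∀ t j → ((((t + suc j) + suc (suc j)) + suc (suc (suc j))) + suc (suc (suc (suc j)))) + suc (suc (suc (suc (suc j))))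
                   ≡ t + (j + 3) * 5
  expand = ℕSolver.solve-∀

-- tri j mod 5 has period 5 in j with values 0, 1, 3, 1, 0, and tri 2 = 3 comes with 2 · 2 + 1 = 5.
jacobiMonomial-classes : ∀ j → tri j ≋ 0 ⊎ tri j ≋ 1 ⊎ + odd j ≡ₘ + 0
jacobiMonomial-classes 0 = inj₁ refl
jacobiMonomial-classes 1 = inj₂ (inj₁ refl)
jacobiMonomial-classes 2 = inj₂ (inj₂ m≡ₘ0)
jacobiMonomial-classes 3 = inj₂ (inj₁ refl)
jacobiMonomial-classes 4 = inj₁ refl
jacobiMonomial-classes (suc (suc (suc (suc (suc j))))) with jacobiMonomial-classes j
... | inj₁ tri≋0        = inj₁ (trans (tri-periodic j) tri≋0)
... | inj₂ (inj₁ tri≋1) = inj₂ (inj₁ (trans (tri-periodic j) tri≋1))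
... | inj₂ (inj₂ 5∣odd) = inj₂ (inj₂ (≡ₘ-trans (≡ₘ-+ m≡ₘ0 (≡ₘ-+ m≡ₘ0 (≡ₘ-refl {+ odd j}))) 5∣odd))

classPart : ℕ → ℕ → Series
classPart c j with tri j % 5 ℕ.≟ c % 5
... | yes _ = jacobiMonomial j
... | no  _ = 0ₛ

InClass-classPart : ∀ c j → InClass c (classPart c j)
InClass-classPart c j with tri j % 5 ℕ.≟ c % 5
... | yes tri≋c = InClass-resp-≋ {tri j} {c} tri≋c (InClass-⋆ {tri j} (alt j ℤ.* + odd j) (InClass-X (tri j)))
... | no  _     = InClass-0ₛ c

jacobiMonomial-split : ∀ j → jacobiMonomial j ≈ₘ classPart 0 j ⊕ classPart 1 j
jacobiMonomial-split j with tri j % 5 ℕ.≟ 0 | tri j % 5 ℕ.≟ 1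
... | yes tri≋0 | yes tri≋1 = ⊥-elim (0≢1 (trans (sym tri≋0) tri≋1))
  where
  0≢1 : ¬ 0 ≡ 1
  0≢1 ()
... | yes _ | no _ = ≈⇒≈ₘ (λ k → sym (ℤP.+-identityʳ _))
... | no _  | yes _ = ≈⇒≈ₘ (λ k → sym (ℤP.+-identityˡ _))
... | no tri≉0 | no tri≉1 with jacobiMonomial-classes j
...   | inj₁ tri≋0        = ⊥-elim (tri≉0 tri≋0)
...   | inj₂ (inj₁ tri≋1) = ⊥-elim (tri≉1 tri≋1)
...   | inj₂ (inj₂ 5∣odd) = λ k → ≡ₘ0-*ˡ (X (tri j) k) (≡ₘ0-*ʳ (alt j) 5∣odd)

jacobi≈ₘ-classes : ∀ n → jacobi n ≈ₘ (∑ₛ[ j < suc n ] classPart 0 j) ⊕ (∑ₛ[ j < suc n ] classPart 1 j)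
jacobi≈ₘ-classes n = ≈ₘ-trans (≈ₘ-∑ₛ (suc n) jacobiMonomial-split)
                               (≈⇒≈ₘ (∑ₛ-distrib-⊕ (suc n) (classPart 0) (classPart 1)))

-- (A₀ + A₁)⁸ = (A₀ + A₁)³ (A₀ + A₁)⁵, where the cube only has exponents ≡ 0, 1, 2, 3 and the fifth power is
-- A₀⁵ + A₁⁵ modulo 5.
DivisibleOn4-^8 : ∀ {A₀ A₁} → InClass 0 A₀ → InClass 1 A₁ → DivisibleOn 4 ((A₀ ⊕ A₁) ^ 8)
DivisibleOn4-^8 {A₀} {A₁} A₀∈0 A₁∈1 =
  DivisibleOn-resp-≈ₘ (≈⇒≈ₘ (≈-sym (^-homo-* (A₀ ⊕ A₁) 3 5))) (DivisibleOn-⊛-InQᵐ cube fifth)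
  where
  monomial : ∀ i j → InClass (i * 0 + j * 1) (A₀ ^ i ⊛ A₁ ^ j)
  monomial i j = InClass-⊛ (InClass-^ i A₀∈0) (InClass-^ j A₁∈1)
  scaled : ∀ c i j → ¬ (i * 0 + j * 1) ≋ 4 → DivisibleOn 4 (const (+ c) ⊛ (A₀ ^ i ⊛ A₁ ^ j))
  scaled c i j class≉4 = InClass⇒DivisibleOn class≉4
    (InClass-resp-≈ {i * 0 + j * 1} (≈-sym (const-⊛ (+ c) _)) (InClass-⋆ (+ c) (monomial i j)))
  cube : DivisibleOn 4 ((A₀ ⊕ A₁) ^ 3)
  cube = DivisibleOn-resp-≈ₘ (≈⇒≈ₘ (≈-sym expand))
    (DivisibleOn-⊕ (DivisibleOn-⊕ (DivisibleOn-⊕ (scaled 1 3 0 λ ()) (scaled 3 2 1 λ ()))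
                                  (scaled 3 1 2 λ ()))
                   (scaled 1 0 3 λ ()))
    where
    expand : (A₀ ⊕ A₁) ^ 3 ≈ const (+ 1) ⊛ (A₀ ^ 3 ⊛ A₁ ^ 0) ⊕ const (+ 3) ⊛ (A₀ ^ 2 ⊛ A₁ ^ 1)
                           ⊕ const (+ 3) ⊛ (A₀ ^ 1 ⊛ A₁ ^ 2) ⊕ const (+ 1) ⊛ (A₀ ^ 0 ⊛ A₁ ^ 3)
    expand = solve 2 (λ a b → (a :+ b) :^ 3 := con (+ 1) :* (a :^ 3 :* b :^ 0) :+ con (+ 3) :* (a :^ 2 :* b :^ 1)
                                               :+ con (+ 3) :* (a :^ 1 :* b :^ 2) :+ con (+ 1) :* (a :^ 0 :* b :^ 3))
             ≈-refl A₀ A₁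
  fifth : InQᵐ ((A₀ ⊕ A₁) ^ 5)
  fifth = InQᵐ-resp-≈ (≈-sym expand)
    (InQᵐ-⊕ (InQᵐ-⊕ (InClass⇒InQᵐ (monomial 5 0)) (InClass⇒InQᵐ (InClass-resp-≋ {5} {0} refl (monomial 0 5))))
            (InQᵐ-m⊛ _))
    where
    expand : (A₀ ⊕ A₁) ^ 5 ≈ A₀ ^ 5 ⊛ A₁ ^ 0 ⊕ A₀ ^ 0 ⊛ A₁ ^ 5 ⊕ const (+ 5) ⊛
               (A₀ ^ 4 ⊛ A₁ ^ 1 ⊕ const (+ 2) ⊛ (A₀ ^ 3 ⊛ A₁ ^ 2)
                ⊕ const (+ 2) ⊛ (A₀ ^ 2 ⊛ A₁ ^ 3) ⊕ A₀ ^ 1 ⊛ A₁ ^ 4)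
    expand = solve 2 (λ a b → (a :+ b) :^ 5 := a :^ 5 :* b :^ 0 :+ a :^ 0 :* b :^ 5 :+ con (+ 5) :*
               (a :^ 4 :* b :^ 1 :+ con (+ 2) :* (a :^ 3 :* b :^ 2) :+ con (+ 2) :* (a :^ 2 :* b :^ 3) :+ a :^ 1 :* b :^ 4))
             ≈-refl A₀ A₁

DivisibleOn4-jacobi^8 : ∀ n → DivisibleOn 4 (jacobi n ^ 8)
DivisibleOn4-jacobi^8 n = DivisibleOn-resp-≈ₘ (≈ₘ-^ 8 (≈ₘ-sym (jacobi≈ₘ-classes n)))
  (DivisibleOn4-^8 (InClass-∑ₛ (suc n) (classPart 0) (InClass-classPart 0))
                   (InClass-∑ₛ (suc n) (classPart 1) (InClass-classPart 1)))

ramanujan-congruence : ∀ n → + p (5 * n + 4) ≡ₘ + 0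
ramanujan-congruence n = subst (_≡ₘ + 0) (sym p[K]≡)
  (DivisibleOn.divisible-at (DivisibleOn-⊛-InQᵐ (DivisibleOn4-jacobi^8 K) (InQᵐ-^ 5 (InQᵐ-parts^5 K))) K K≋4)
  where
  K = 5 * n + 4
  K≋4 : K ≋ 4
  K≋4 = trans (cong (_% 5) (trans (ℕP.+-comm (5 * n) 4) (cong (_+_ 4) (ℕP.*-comm 5 n)))) ([m+kn]%n≡m%n 4 n 5)
  p[K]≡ : + p K ≡ (jacobi K ^ 8 ⊛ (parts K ^ 5) ^ 5) K
  p[K]≡ = trans (parts-decomposition K K)
             (≈[]-⊛ (≈[]-trans (≈⇒≈[] K (≈-sym (^-assocʳ (poch K) 3 8))) (≈[]-^ 8 (poch³-≈[]-jacobi K)))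
                    (≈[]-refl K) K ℕP.≤-refl)

proposition6p11 : (n : ℕ) → (+ 5) ∣ M̂χ₅₁₁ (5 * n + 4)
proposition6p11 n = ∣⇒∣ᵤ (≡ₘ0⇒∣ (≡ₘ-trans (M̂χ₅₁₁≡ₘNp K) (≡ₘ0-*ʳ (+ K) (ramanujan-congruence n))))
  where
  K = 5 * n + 4
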